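{- Let $\Delta$ be a theta graph with trivalent nodes $v$ and $w$, and let $\Omega$ be a biased expansion of $\Delta$. Then $\Omega$ extends to a new link $e_{vw}$ joining $v$ and $w$, i.e. there is a biased expansion of $\Delta\cup\{e_{vw}\}$ whose restriction to the preimage of $\Delta$ is $\Omega$.
   Context: A theta graph is the union of three internally disjoint paths with the same two endpoints, its trivalent nodes. A biased graph is a graph with a set of circles, called balanced, such that no theta subgraph contains exactly two balanced circles. A biased expansion of $\Delta$ is a biased graph $\Omega$ with surjective $p:\|\Omega\|\to\Delta$, identity on nodes, no balanced digon in any fiber, and the circle lifting property (for every circle $e_1\cdots e_l$ of $\Delta$ and any $\tilde e_i\in p^{ -1}(e_i)$, $i<l$, exactly one $\tilde e_l\in p^{ -1}(e_l)$ makes $\tilde e_1\cdots\tilde e_l$ balanced). The restriction of an expansion $\Omega'\downarrow_{p'}\Delta'$ to $\Delta\subseteq\Delta'$ is $p'^{ -1}(\Delta)$ with inherited balanced circles and projection. -}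

module Defs where

open import Data.Nat using (ℕ; _<_)
open import Data.Product using (Σ; ∃; ∃!; _×_; _,_)
open import Data.Sum using (_⊎_)
open import Data.Maybe using (Maybe; just; nothing)
open import Data.Empty using (⊥)
open import Data.List using (List; []; _∷_; _++_; [_]; length; drop; map)
open import Data.List.Membership.Propositional using (_∈_)
open import Data.List.Relation.Unary.Unique.Propositional using (Unique)
open import Data.List.Relation.Binary.Permutation.Propositional using (_↭_)
open import Relation.Nullary using (¬_)
open import Relation.Binary.PropositionalEquality using (_≡_)
open import Function.Bundles using (_⇔_)

-- Graphs with node set V (edges are links or loops; each edge has two
-- ends, stored as an ordered pair but read as unordered).

record Graph (V : Set) : Set₁ where
  field
    Edge : Set
    ends : Edge → V × V

open Graph public

module _ {V : Set} (G : Graph V) where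

  Joins : Edge G → V → V → Set
  Joins e x y = ends G e ≡ (x , y) ⊎ ends G e ≡ (y , x)

  data Walk : V → V → Set where
    []   : ∀ {x} → Walk x x
    step : ∀ {x y z} (e : Edge G) → Joins e x y → Walk y z → Walk x z

module _ {V : Set} {G : Graph V} where

  edges : ∀ {x y} → Walk G x y → List (Edge G)
  edges []           = []
  edges (step e _ w) = e ∷ edges w

  starts : ∀ {x y} → Walk G x y → List V
  starts []                 = []
  starts (step {x} _ _ w)   = x ∷ starts w

  allNodes : ∀ {x y} → Walk G x y → List V
  allNodes {y = y} w = starts w ++ [ y ]

  innerNodes : ∀ {x y} → Walk G x y → List V
  innerNodes w = drop 1 (starts w)

  _++ʷ_ : ∀ {x y z} → Walk G x y → Walk G y z → Walk G x z
  []           ++ʷ u = u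
  (step e j w) ++ʷ u = step e j (w ++ʷ u)

  IsPath : ∀ {x y} → Walk G x y → Set
  IsPath w = Unique (allNodes w)

  IsCircle : ∀ {x} → Walk G x x → Set
  IsCircle w = (0 < length (edges w)) × Unique (starts w) × Unique (edges w)

Disjoint : {A : Set} → List A → List A → Set
Disjoint L L' = ∀ {z} → z ∈ L → z ∈ L' → ⊥

module _ {V : Set} (G : Graph V) where

  record Circle : Set where
    field
      base     : V
      walk     : Walk G base base
      isCircle : IsCircle walk

  record Theta (a b : V) : Set where
    field
      a≢b : ¬ (a ≡ b)
      P₁ P₂ P₃ : Walk G a b
      path₁ : IsPath P₁
      path₂ : IsPath P₂
      path₃ : IsPath P₃
      inner₁₂ : Disjoint (innerNodes P₁) (innerNodes P₂)
      inner₁₃ : Disjoint (innerNodes P₁) (innerNodes P₃)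
      inner₂₃ : Disjoint (innerNodes P₂) (innerNodes P₃)
      edges₁₂ : Disjoint (edges P₁) (edges P₂)
      edges₁₃ : Disjoint (edges P₁) (edges P₃)
      edges₂₃ : Disjoint (edges P₂) (edges P₃)

  IsThetaGraph : V → V → Set
  IsThetaGraph v w =
    Σ (Theta v w) λ T →
      let open Theta T in
      (∀ (e : Edge G) → e ∈ edges P₁ ⊎ e ∈ edges P₂ ⊎ e ∈ edges P₃)
      × (∀ (x : V) → x ∈ allNodes P₁ ⊎ x ∈ allNodes P₂ ⊎ x ∈ allNodes P₃)

-- The class of balanced circles is given by a predicate
-- on edge lists, invariant under permutation (a circle is determined by
-- its edge set); only its values on edge lists of circles matter.

record BiasedGraph (V : Set) : Set₁ where
  field
    graph : Graph V
    Bal   : List (Edge graph) → Set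
    Bal-↭ : ∀ {L L'} → L ↭ L' → Bal L → Bal L'
    -- no theta subgraph contains exactly two balanced circles
    theta : ∀ {a b} (T : Theta graph a b) →
      let open Theta T in
      ¬ (Bal (edges P₁ ++ edges P₂) × Bal (edges P₁ ++ edges P₃)
           × ¬ Bal (edges P₂ ++ edges P₃))

open BiasedGraph public

-- Biased expansions Ω ↓ Δ.  Ω has the same node set V as Δ (p is the
-- identity on nodes); p acts on edges.

record Expansion {V : Set} (Δ : Graph V) : Set₁ where
  field
    Ω      : BiasedGraph V
    p      : Edge (graph Ω) → Edge Δ
    p-joins : ∀ e x y → Joins (graph Ω) e x y → Joins Δ (p e) x y
    p-surj : ∀ d → ∃ λ e → p e ≡ d
    no-bal-digon : ∀ (C : Circle (graph Ω)) e f →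
      edges (Circle.walk C) ≡ e ∷ f ∷ [] → p e ≡ p f →
      ¬ Bal Ω (e ∷ f ∷ [])
    -- circle lifting property: for the circle e₁⋯eₗ of Δ (given as a
    -- closed walk w₀ followed by the last edge eₗ) and lifts ẽ₁,…,ẽ_{l-1}
    -- (an Ω-walk w̃₀ over w₀), exactly one ẽₗ over eₗ makes ẽ₁⋯ẽₗ balanced
    lifting : ∀ {x y} (w₀ : Walk Δ x y) (eₗ : Edge Δ) (j : Joins Δ eₗ y x) →
      IsCircle (w₀ ++ʷ step eₗ j []) →
      (w̃₀ : Walk (graph Ω) x y) → map p (edges w̃₀) ≡ edges w₀ →
      ∃! _≡_ (λ ẽ → p ẽ ≡ eₗ × Bal Ω (edges w̃₀ ++ [ ẽ ]))

open Expansion public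

-- Δ ∪ {e_vw}: add a new link (nothing) joining v and w.

addLink : {V : Set} → Graph V → V → V → Graph V
addLink Δ v w = record
  { Edge = Maybe (Edge Δ)
  ; ends = λ { nothing → (v , w) ; (just e) → ends Δ e } }

-- The restriction of X' (over Δ ∪ {e_vw}) to p'⁻¹(Δ) is (isomorphic
-- to) X: an edge bijection ι from Ω onto p'⁻¹(Δ), identity on nodes,
-- commuting with projections and preserving balance of circles.
record RestrictsTo {V : Set} {Δ : Graph V} {v w : V}
                   (X' : Expansion (addLink Δ v w)) (X : Expansion Δ) : Set where
  field
    ι       : Edge (graph (Ω X)) → Edge (graph (Ω X'))
    ι-inj   : ∀ e f → ι e ≡ ι f → e ≡ f
    ι-ends  : ∀ e → ends (graph (Ω X')) (ι e) ≡ ends (graph (Ω X)) e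
    ι-p     : ∀ e → p X' (ι e) ≡ just (p X e)
    ι-onto  : ∀ e' d → p X' e' ≡ just d → ∃ λ e → ι e ≡ e'
    ι-bal   : ∀ (C : Circle (graph (Ω X))) →
      Bal (Ω X) (edges (Circle.walk C)) ⇔ Bal (Ω X') (map ι (edges (Circle.walk C)))

{-# OPTIONS --safe #-}
-- Write the theta graph Δ as three v–w paths P arm₁, P arm₂, P arm₃ and fix, in Ω, a lift of each
-- of them minus its first edge.  A lift of P arm₁ is then named by its first edge n, and circle
-- lifting in Ω gives for every other arm r a unique lift of P r, the companion of n over r, that
-- forms a balanced circle with it.  The extension gets one new edge over e_vw for each n, which
-- behaves like its companions: a circle made of n and old edges is balanced when the old edges
-- close up to a balanced circle with the companion of n over an arm they avoid, and a circle
-- through two new edges is unbalanced.  Circle lifting through e_vw then reduces to circle lifting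
-- in Ω around an arm, and the theta property for a theta through a new edge reduces to the theta
-- property of Ω for two of its paths together with a companion of n.
module Submission where

open import Defs
open import Axiom.UniquenessOfIdentityProofs.WithK using (uip)
open import Data.Empty using (⊥; ⊥-elim)
open import Data.List using (List; []; _∷_; _++_; [_]; map; reverse; length; drop; concatMap; catMaybes)
open import Data.List.Properties
  using (∷-injective; length-map; ++-assoc; ++-identityʳ; map-++; unfold-reverse; reverse-map; catMaybes-++; mapMaybe-just; map-injective)
open import Data.List.Membership.Propositional using (_∈_; _∉_; lose)
open import Data.List.Membership.Propositional.Properties using (∈-++⁺ˡ; ∈-++⁺ʳ; ∈-++⁻; ∈-map⁺; ∈-map⁻; ∈-length)
open import Data.List.Relation.Unary.Any using (Any; here; there; any?)
open import Data.List.Relation.Unary.All as All using (All; []; _∷_)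
open import Data.List.Relation.Unary.All.Properties as All using (¬Any⇒All¬; All¬⇒¬Any)
open import Data.List.Relation.Unary.AllPairs as AllPairs using ([]; _∷_)
open import Data.List.Relation.Unary.Unique.Propositional using (Unique)
open import Data.List.Relation.Unary.Unique.Propositional.Properties
  using (Unique[x∷xs]⇒x∉xs) renaming (map⁻ to Unique-map⁻; ++⁺ to Unique-++⁺)
open import Data.List.Relation.Binary.Permutation.Propositional as ↭
  using (_↭_; ↭-refl; ↭-sym; ↭-trans; ↭-reflexive; ↭-prep; ↭-swap; ↭⇒↭ₛ; module PermutationReasoning)
open import Data.List.Relation.Binary.Permutation.Propositional.Properties
  using (↭-length; ∈-resp-↭; ↭-singleton-inv; ↭-empty-inv; ++⁺ˡ; ++⁺ʳ; ++⁺; shifts; drop-∷; ↭-reverse; All-resp-↭; Any-resp-↭)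
  renaming (++-comm to ↭-++-comm; map⁺ to ↭-map⁺)
import Data.List.Relation.Binary.Permutation.Setoid.Properties as SetoidPermutation
open import Data.Maybe using (Maybe; just; nothing)
open import Data.Maybe.Properties using (just-injective)
open import Data.Nat using (_<_; s≤s; z≤n)
open import Data.Product using (Σ; ∃; ∃!; _×_; _,_; proj₁; proj₂)
open import Data.Product.Properties using (,-injectiveˡ; ,-injectiveʳ)
open import Data.Sum using (_⊎_; inj₁; inj₂)
open import Data.Sum.Properties using (inj₁-injective)
open import Effect.Monad using (RawMonad)
open import Level using (0ℓ)
open import Function.Base using (_∘_; id)
open import Function.Bundles using (_⇔_; mk⇔; Equivalence)
open import Function.Properties.Equivalence using () renaming (trans to Equivalence-trans; sym to Equivalence-sym)
open import Relation.Binary.PropositionalEquality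
  using (_≡_; _≢_; refl; sym; trans; cong; cong₂; subst; subst₂; ≢-sym; setoid; module ≡-Reasoning)
open import Relation.Nullary using (¬_; Dec; yes; no)
open import Relation.Nullary.Negation using (¬¬-Monad)
open RawMonad (¬¬-Monad {a = 0ℓ}) using (pure; _>>=_)

Unique-∷ : {A : Set} {x : A} {xs : List A} → x ∉ xs → Unique xs → Unique (x ∷ xs)
Unique-∷ x∉xs u = ¬Any⇒All¬ _ x∉xs ∷ u

Unique-resp-↭ : {A : Set} {xs ys : List A} → xs ↭ ys → Unique xs → Unique ys
Unique-resp-↭ {A} p = SetoidPermutation.Unique-resp-↭ (setoid A) (↭⇒↭ₛ p)

Unique-++ : {A : Set} {xs ys : List A} → Unique xs → Unique ys → Disjoint xs ys → Unique (xs ++ ys)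
Unique-++ u v d = Unique-++⁺ u v (λ (p , q) → d p q)

Unique-++⁻ˡ : {A : Set} (xs : List A) {ys : List A} → Unique (xs ++ ys) → Unique xs
Unique-++⁻ˡ []       _ = []
Unique-++⁻ˡ (x ∷ xs) u =
  Unique-∷ (λ m → Unique[x∷xs]⇒x∉xs u (∈-++⁺ˡ m)) (Unique-++⁻ˡ xs (AllPairs.tail u))

Unique-++⇒Disjoint : {A : Set} (xs : List A) {ys : List A} → Unique (xs ++ ys) → Disjoint xs ys
Unique-++⇒Disjoint (x ∷ xs) u (here refl) q = Unique[x∷xs]⇒x∉xs u (∈-++⁺ʳ xs q)
Unique-++⇒Disjoint (x ∷ xs) u (there p)   q = Unique-++⇒Disjoint xs (AllPairs.tail u) p q

∈-catMaybes⁻ : {A : Set} {a : A} (xs : List (Maybe A)) → a ∈ catMaybes xs → just a ∈ xs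
∈-catMaybes⁻ (just b ∷ xs)  (here refl) = here refl
∈-catMaybes⁻ (just b ∷ xs)  (there m)   = there (∈-catMaybes⁻ xs m)
∈-catMaybes⁻ (nothing ∷ xs) m           = there (∈-catMaybes⁻ xs m)

Unique-catMaybes : {A : Set} (xs : List (Maybe A)) → Unique xs → Unique (catMaybes xs)
Unique-catMaybes []             _ = []
Unique-catMaybes (just a ∷ xs)  u =
  Unique-∷ (λ m → Unique[x∷xs]⇒x∉xs u (∈-catMaybes⁻ xs m)) (Unique-catMaybes xs (AllPairs.tail u))
Unique-catMaybes (nothing ∷ xs) u = Unique-catMaybes xs (AllPairs.tail u)

all-just : {A : Set} (L : List (Maybe A)) → nothing ∉ L → All (λ d → Σ A λ a → just a ≡ d) L
all-just []             _         = []
all-just (just a ∷ L)  nothing∉ = (a , refl) ∷ all-just L (λ p → nothing∉ (there p))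
all-just (nothing ∷ L) nothing∉ = ⊥-elim (nothing∉ (here refl))

snoc-++-↭ : {A : Set} (xs ys : List A) (y : A) → (xs ++ [ y ]) ++ ys ↭ (xs ++ ys) ++ [ y ]
snoc-++-↭ xs ys y = begin
  (xs ++ [ y ]) ++ ys   ≡⟨ ++-assoc xs [ y ] ys ⟩
  xs ++ y ∷ ys          ↭⟨ ++⁺ˡ xs (↭-++-comm [ y ] ys) ⟩
  xs ++ ys ++ [ y ]     ≡⟨ ++-assoc xs ys [ y ] ⟨
  (xs ++ ys) ++ [ y ]   ∎
  where open PermutationReasoning

++-snoc-rotate : {A : Set} (xs ys : List A) (y : A) → (ys ++ xs) ++ [ y ] ↭ xs ++ y ∷ ys
++-snoc-rotate xs ys y = begin
  (ys ++ xs) ++ [ y ]   ≡⟨ ++-assoc ys xs [ y ] ⟩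
  ys ++ xs ++ [ y ]     ↭⟨ ↭-++-comm ys (xs ++ [ y ]) ⟩
  (xs ++ [ y ]) ++ ys   ≡⟨ ++-assoc xs [ y ] ys ⟩
  xs ++ y ∷ ys          ∎
  where open PermutationReasoning

¬¬⊥⇒⊥ : ¬ ¬ ⊥ → ⊥
¬¬⊥⇒⊥ ¬¬false = ¬¬false (λ false → false)

∃!-map : {A : Set} {P Q : A → Set} → (∀ {a} → P a → Q a) → (∀ {a} → Q a → P a) →
         ∃! _≡_ P → ∃! _≡_ Q
∃!-map to from (a , pa , unique) = a , to pa , λ qb → unique (from qb)

∃!-pushforward : {A B : Set} {Q : B → Set} (f : A → B) → (∀ {b} → Q b → Σ A λ a → f a ≡ b) →
                 ∃! _≡_ (λ a → Q (f a)) → ∃! _≡_ Q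
∃!-pushforward {A} {Q = Q} f onto (a , qa , unique) = f a , qa , λ qb → same qb (onto qb)
  where
  same : ∀ {b} → Q b → (Σ A λ a' → f a' ≡ b) → f a ≡ b
  same qb (a' , refl) = cong f (unique qb)

∃!-pullback : {A B : Set} {Q : B → Set} (f : A → B) → (∀ {a a'} → f a ≡ f a' → a ≡ a') →
              (∀ {b} → Q b → Σ A λ a → f a ≡ b) → ∃! _≡_ Q → ∃! _≡_ (λ a → Q (f a))
∃!-pullback f injective onto (b , qb , unique) with onto qb
... | a , refl = a , qb , λ qa' → injective (unique qa')

module _ {A B : Set} where

  lefts : List (A ⊎ B) → List A
  lefts []             = []
  lefts (inj₁ a ∷ xs) = a ∷ lefts xs
  lefts (inj₂ _ ∷ xs) = lefts xs

  rights : List (A ⊎ B) → List B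
  rights []             = []
  rights (inj₁ _ ∷ xs) = rights xs
  rights (inj₂ b ∷ xs) = b ∷ rights xs

  lefts-↭ : {xs ys : List (A ⊎ B)} → xs ↭ ys → lefts xs ↭ lefts ys
  lefts-↭ ↭.refl                          = ↭-refl
  lefts-↭ (↭.prep (inj₁ x) p)             = ↭-prep x (lefts-↭ p)
  lefts-↭ (↭.prep (inj₂ _) p)             = lefts-↭ p
  lefts-↭ (↭.swap (inj₁ x) (inj₁ y) p)    = ↭-swap x y (lefts-↭ p)
  lefts-↭ (↭.swap (inj₁ x) (inj₂ _) p)    = ↭-prep x (lefts-↭ p)
  lefts-↭ (↭.swap (inj₂ _) (inj₁ y) p)    = ↭-prep y (lefts-↭ p)
  lefts-↭ (↭.swap (inj₂ _) (inj₂ _) p)    = lefts-↭ p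
  lefts-↭ (↭.trans p q)                   = ↭-trans (lefts-↭ p) (lefts-↭ q)

  rights-↭ : {xs ys : List (A ⊎ B)} → xs ↭ ys → rights xs ↭ rights ys
  rights-↭ ↭.refl                         = ↭-refl
  rights-↭ (↭.prep (inj₁ _) p)            = rights-↭ p
  rights-↭ (↭.prep (inj₂ x) p)            = ↭-prep x (rights-↭ p)
  rights-↭ (↭.swap (inj₁ _) (inj₁ _) p)   = rights-↭ p
  rights-↭ (↭.swap (inj₁ _) (inj₂ y) p)   = ↭-prep y (rights-↭ p)
  rights-↭ (↭.swap (inj₂ x) (inj₁ _) p)   = ↭-prep x (rights-↭ p)
  rights-↭ (↭.swap (inj₂ x) (inj₂ y) p)   = ↭-swap x y (rights-↭ p)
  rights-↭ (↭.trans p q)                  = ↭-trans (rights-↭ p) (rights-↭ q)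

  lefts-++ : (xs ys : List (A ⊎ B)) → lefts (xs ++ ys) ≡ lefts xs ++ lefts ys
  lefts-++ []             ys = refl
  lefts-++ (inj₁ x ∷ xs) ys = cong (x ∷_) (lefts-++ xs ys)
  lefts-++ (inj₂ _ ∷ xs) ys = lefts-++ xs ys

  rights-++ : (xs ys : List (A ⊎ B)) → rights (xs ++ ys) ≡ rights xs ++ rights ys
  rights-++ []             ys = refl
  rights-++ (inj₁ _ ∷ xs) ys = rights-++ xs ys
  rights-++ (inj₂ x ∷ xs) ys = cong (x ∷_) (rights-++ xs ys)

  lefts-map-inj₁ : (xs : List A) → lefts (map inj₁ xs) ≡ xs
  lefts-map-inj₁ []       = refl
  lefts-map-inj₁ (x ∷ xs) = cong (x ∷_) (lefts-map-inj₁ xs)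

  rights-map-inj₁ : (xs : List A) → rights (map inj₁ xs) ≡ []
  rights-map-inj₁ []       = refl
  rights-map-inj₁ (x ∷ xs) = rights-map-inj₁ xs

module _ {V : Set} {G : Graph V} where

  Joins-sym : ∀ {e x y} → Joins G e x y → Joins G e y x
  Joins-sym (inj₁ p) = inj₂ p
  Joins-sym (inj₂ p) = inj₁ p

  Joins-ends : ∀ {e x y s t} → Joins G e x y → Joins G e s t → (s ≡ x × t ≡ y) ⊎ (s ≡ y × t ≡ x)
  Joins-ends (inj₁ p) (inj₁ q) = inj₁ (,-injectiveˡ (trans (sym q) p) , ,-injectiveʳ (trans (sym q) p))
  Joins-ends (inj₁ p) (inj₂ q) = inj₂ (,-injectiveʳ (trans (sym q) p) , ,-injectiveˡ (trans (sym q) p))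
  Joins-ends (inj₂ p) (inj₁ q) = inj₂ (,-injectiveˡ (trans (sym q) p) , ,-injectiveʳ (trans (sym q) p))
  Joins-ends (inj₂ p) (inj₂ q) = inj₁ (,-injectiveʳ (trans (sym q) p) , ,-injectiveˡ (trans (sym q) p))

  Joins-other-end : ∀ {e x y t} → Joins G e x y → Joins G e x t → t ≡ y
  Joins-other-end j k with Joins-ends j k
  ... | inj₁ (_ , t≡y)   = t≡y
  ... | inj₂ (x≡y , t≡x) = trans t≡x x≡y

  Joins-between-ends : ∀ {a b e s t} → Joins G e s t → s ≡ a ⊎ s ≡ b → t ≡ a ⊎ t ≡ b → s ≢ t → Joins G e a b
  Joins-between-ends j (inj₁ refl) (inj₁ refl) s≢t = ⊥-elim (s≢t refl)
  Joins-between-ends j (inj₁ refl) (inj₂ refl) _   = j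
  Joins-between-ends j (inj₂ refl) (inj₁ refl) _   = Joins-sym j
  Joins-between-ends j (inj₂ refl) (inj₂ refl) s≢t = ⊥-elim (s≢t refl)

  edges-++ʷ : ∀ {x y z} (u : Walk G x y) (u' : Walk G y z) → edges (u ++ʷ u') ≡ edges u ++ edges u'
  edges-++ʷ []           u' = refl
  edges-++ʷ (step e j u) u' = cong (e ∷_) (edges-++ʷ u u')

  starts-++ʷ : ∀ {x y z} (u : Walk G x y) (u' : Walk G y z) → starts (u ++ʷ u') ≡ starts u ++ starts u'
  starts-++ʷ []           u' = refl
  starts-++ʷ (step e j u) u' = cong (_ ∷_) (starts-++ʷ u u')

  allNodes-++ʷ : ∀ {x y z} (u : Walk G x y) (u' : Walk G y z) → allNodes (u ++ʷ u') ≡ starts u ++ allNodes u'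
  allNodes-++ʷ {z = z} u u' = trans (cong (_++ [ z ]) (starts-++ʷ u u')) (++-assoc (starts u) (starts u') [ z ])

  ++ʷ-assoc : ∀ {x y z t} (u : Walk G x y) (u' : Walk G y z) (u'' : Walk G z t) →
              (u ++ʷ u') ++ʷ u'' ≡ u ++ʷ (u' ++ʷ u'')
  ++ʷ-assoc []           u' u'' = refl
  ++ʷ-assoc (step e j u) u' u'' = cong (step e j) (++ʷ-assoc u u' u'')

  edges-++ʷ-comm : ∀ {x y} (c : Walk G x y) (d : Walk G y x) → edges (c ++ʷ d) ↭ edges (d ++ʷ c)
  edges-++ʷ-comm c d =
    ↭-trans (↭-reflexive (edges-++ʷ c d)) (↭-trans (↭-++-comm (edges c) (edges d)) (↭-reflexive (sym (edges-++ʷ d c))))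

  reverseʷ : ∀ {x y} → Walk G x y → Walk G y x
  reverseʷ []           = []
  reverseʷ (step e j u) = reverseʷ u ++ʷ step e (Joins-sym j) []

  edges-reverseʷ : ∀ {x y} (u : Walk G x y) → edges (reverseʷ u) ≡ reverse (edges u)
  edges-reverseʷ []           = refl
  edges-reverseʷ (step e j u) = begin
    edges (reverseʷ u ++ʷ step e (Joins-sym j) [])  ≡⟨ edges-++ʷ (reverseʷ u) _ ⟩
    edges (reverseʷ u) ++ [ e ]                      ≡⟨ cong (_++ [ e ]) (edges-reverseʷ u) ⟩
    reverse (edges u) ++ [ e ]                       ≡⟨ unfold-reverse e (edges u) ⟨
    reverse (e ∷ edges u)                            ∎
    where open ≡-Reasoning

  allNodes-reverseʷ : ∀ {x y} (u : Walk G x y) → allNodes (reverseʷ u) ≡ reverse (allNodes u)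
  allNodes-reverseʷ []                   = refl
  allNodes-reverseʷ {x} (step e j u) = begin
    allNodes (reverseʷ u ++ʷ step e (Joins-sym j) [])  ≡⟨ allNodes-++ʷ (reverseʷ u) _ ⟩
    starts (reverseʷ u) ++ [ _ ] ++ [ x ]             ≡⟨ ++-assoc (starts (reverseʷ u)) _ [ x ] ⟨
    allNodes (reverseʷ u) ++ [ x ]                     ≡⟨ cong (_++ [ x ]) (allNodes-reverseʷ u) ⟩
    reverse (allNodes u) ++ [ x ]                      ≡⟨ unfold-reverse x (allNodes u) ⟨
    reverse (x ∷ allNodes u)                           ∎
    where open ≡-Reasoning

  edges-reverseʷ-↭ : ∀ {x y} (u : Walk G x y) → edges (reverseʷ u) ↭ edges u
  edges-reverseʷ-↭ u = ↭-trans (↭-reflexive (edges-reverseʷ u)) (↭-reverse (edges u))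

  allNodes-reverseʷ-↭ : ∀ {x y} (u : Walk G x y) → allNodes (reverseʷ u) ↭ allNodes u
  allNodes-reverseʷ-↭ u = ↭-trans (↭-reflexive (allNodes-reverseʷ u)) (↭-reverse (allNodes u))

  starts-reverseʷ-↭ : ∀ {x y} (u : Walk G x y) → x ∷ starts (reverseʷ u) ↭ allNodes u
  starts-reverseʷ-↭ {x} u = ↭-trans (↭-++-comm [ x ] (starts (reverseʷ u))) (allNodes-reverseʷ-↭ u)

  IsPath-reverseʷ : ∀ {x y} {u : Walk G x y} → IsPath u → IsPath (reverseʷ u)
  IsPath-reverseʷ {u = u} = Unique-resp-↭ (↭-sym (allNodes-reverseʷ-↭ u))

  source∈allNodes : ∀ {x y} (u : Walk G x y) → x ∈ allNodes u
  source∈allNodes []           = here refl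
  source∈allNodes (step e j u) = here refl

  target∈allNodes : ∀ {x y} (u : Walk G x y) → y ∈ allNodes u
  target∈allNodes []           = here refl
  target∈allNodes (step e j u) = there (target∈allNodes u)

  ends∈allNodes : ∀ {x y e s t} (u : Walk G x y) → e ∈ edges u → Joins G e s t →
                  s ∈ allNodes u × t ∈ allNodes u
  ends∈allNodes (step e j u) (here refl) k with Joins-ends j k
  ... | inj₁ (refl , refl) = here refl , there (source∈allNodes u)
  ... | inj₂ (refl , refl) = there (source∈allNodes u) , here refl
  ends∈allNodes (step e j u) (there m) k =
    let (s∈ , t∈) = ends∈allNodes u m k in there s∈ , there t∈

  innerNodes⊆allNodes : ∀ {a b z} (u : Walk G a b) → z ∈ innerNodes u → z ∈ allNodes u
  innerNodes⊆allNodes (step e j u) m = there (∈-++⁺ˡ m)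

  ∈starts⇒outgoing : ∀ {x y z} (u : Walk G x y) → z ∈ starts u →
                     Σ (Edge G) λ e → Σ V λ t → e ∈ edges u × Joins G e z t
  ∈starts⇒outgoing (step e j u) (here refl) = e , _ , here refl , j
  ∈starts⇒outgoing (step e j u) (there m)   =
    let (e' , t , e'∈ , k) = ∈starts⇒outgoing u m in e' , t , there e'∈ , k

  first-edge : ∀ {x y} (u : Walk G x y) → x ≢ y → Σ (Edge G) λ e → Σ V λ t → e ∈ edges u × Joins G e x t
  first-edge []           x≢y = ⊥-elim (x≢y refl)
  first-edge (step e j u) _   = e , _ , here refl , j

  record Split {x y : V} (u : Walk G x y) (e : Edge G) : Set where
    field
      {s t}  : V
      before : Walk G x s
      joins  : Joins G e s t
      after  : Walk G t y
      split  : u ≡ before ++ʷ step e joins after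

  split-at : ∀ {x y e} (u : Walk G x y) → e ∈ edges u → Split u e
  split-at (step e j u) (here refl) = record { before = [] ; joins = j ; after = u ; split = refl }
  split-at (step e j u) (there e∈)  =
    let sp = split-at u e∈ in
    record { before = step e j (Split.before sp) ; joins = Split.joins sp ; after = Split.after sp
           ; split = cong (step e j) (Split.split sp) }

  allNodes-trichotomy : ∀ {a b z} (u : Walk G a b) → z ∈ allNodes u → z ≡ a ⊎ z ∈ innerNodes u ⊎ z ≡ b
  allNodes-trichotomy []           (here refl) = inj₁ refl
  allNodes-trichotomy (step e j u) (here refl) = inj₁ refl
  allNodes-trichotomy (step e j u) (there m) with ∈-++⁻ (starts u) m
  ... | inj₁ z∈ = inj₂ (inj₁ z∈)
  ... | inj₂ (here refl) = inj₂ (inj₂ refl)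

  source∉innerNodes : ∀ {a b} (u : Walk G a b) → IsPath u → a ∉ innerNodes u
  source∉innerNodes (step e j u) p m = Unique[x∷xs]⇒x∉xs p (∈-++⁺ˡ m)

  target∉innerNodes : ∀ {a b} (u : Walk G a b) → IsPath u → b ∉ innerNodes u
  target∉innerNodes (step e j u) p m = Unique-++⇒Disjoint (starts u) (AllPairs.tail p) m (here refl)

  common-node-is-end : ∀ {a b z} (Q Q' : Walk G a b) → IsPath Q → IsPath Q' → Disjoint (innerNodes Q) (innerNodes Q') →
                       z ∈ allNodes Q → z ∈ allNodes Q' → z ≡ a ⊎ z ≡ b
  common-node-is-end Q Q' Q-path Q'-path inner-disjoint z∈Q z∈Q'
    with allNodes-trichotomy Q z∈Q | allNodes-trichotomy Q' z∈Q'
  ... | inj₁ z≡a         | _                = inj₁ z≡a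
  ... | inj₂ (inj₂ z≡b)  | _                = inj₂ z≡b
  ... | inj₂ (inj₁ z∈)   | inj₁ refl        = ⊥-elim (source∉innerNodes Q Q-path z∈)
  ... | inj₂ (inj₁ z∈)   | inj₂ (inj₂ refl) = ⊥-elim (target∉innerNodes Q Q-path z∈)
  ... | inj₂ (inj₁ z∈)   | inj₂ (inj₁ z∈′)  = ⊥-elim (inner-disjoint z∈ z∈′)

  IsPath⇒Unique-edges : ∀ {x y} {u : Walk G x y} → IsPath u → Unique (edges u)
  IsPath⇒Unique-edges {u = []}         _ = []
  IsPath⇒Unique-edges {u = step e j u} p =
    Unique-∷ (λ m → Unique[x∷xs]⇒x∉xs p (proj₁ (ends∈allNodes u m j))) (IsPath⇒Unique-edges (AllPairs.tail p))

  closed-path-edges : ∀ {x} (u : Walk G x x) → IsPath u → edges u ≡ []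
  closed-path-edges []           _ = refl
  closed-path-edges (step e j u) p = ⊥-elim (Unique[x∷xs]⇒x∉xs p (target∈allNodes u))

  path-source-edge-unique : ∀ {x y e e' s s'} (u : Walk G x y) → IsPath u → e ∈ edges u → e' ∈ edges u →
                            Joins G e x s → Joins G e' x s' → e ≡ e'
  path-source-edge-unique (step _ _ u) p (here refl) (here refl) _ _ = refl
  path-source-edge-unique (step _ _ u) p _ (there m) _ k = ⊥-elim (Unique[x∷xs]⇒x∉xs p (proj₁ (ends∈allNodes u m k)))
  path-source-edge-unique (step _ _ u) p (there m) _ k _ = ⊥-elim (Unique[x∷xs]⇒x∉xs p (proj₁ (ends∈allNodes u m k)))

  path-single-edge : ∀ {a b e} (u : Walk G a b) → IsPath u → e ∈ edges u → Joins G e a b → edges u ≡ [ e ]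
  path-single-edge (step e j u) p (here refl) k with Joins-ends j k
  ... | inj₁ (_ , refl)  = cong (e ∷_) (closed-path-edges u (AllPairs.tail p))
  ... | inj₂ (refl , _)  = ⊥-elim (Unique[x∷xs]⇒x∉xs p (source∈allNodes u))
  path-single-edge (step e j u) p (there m) k = ⊥-elim (Unique[x∷xs]⇒x∉xs p (proj₁ (ends∈allNodes u m k)))

  path-edge-not-loop : ∀ {x y e s} (u : Walk G x y) → IsPath u → e ∈ edges u → ¬ Joins G e s s
  path-edge-not-loop (step e j u) p (here refl) k with Joins-ends j k
  ... | inj₁ (refl , refl) = Unique[x∷xs]⇒x∉xs p (source∈allNodes u)
  ... | inj₂ (refl , refl) = Unique[x∷xs]⇒x∉xs p (source∈allNodes u)
  path-edge-not-loop (step e j u) p (there m) k = path-edge-not-loop u (AllPairs.tail p) m k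

  private
    first-and-two-more : ∀ {x y z e₀ e₂ e₃ t₀ t₂ t₃} {j : Joins G e₀ x y} (u : Walk G y z) → IsPath (step e₀ j u) →
                         e₂ ∈ edges u → e₃ ∈ edges u → e₂ ≢ e₃ →
                         ∀ {c} → Joins G e₀ c t₀ → Joins G e₂ c t₂ → Joins G e₃ c t₃ → ⊥
    first-and-two-more {j = j} u p m₂ m₃ e₂≢e₃ k₀ k₂ k₃ with Joins-ends j k₀
    ... | inj₁ (refl , refl) = Unique[x∷xs]⇒x∉xs p (proj₁ (ends∈allNodes u m₂ k₂))
    ... | inj₂ (refl , refl) = e₂≢e₃ (path-source-edge-unique u (AllPairs.tail p) m₂ m₃ k₂ k₃)

  path-no-three-edges-at : ∀ {x y c e₁ e₂ e₃ t₁ t₂ t₃} (u : Walk G x y) → IsPath u →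
    e₁ ∈ edges u → e₂ ∈ edges u → e₃ ∈ edges u → e₁ ≢ e₂ → e₁ ≢ e₃ → e₂ ≢ e₃ →
    Joins G e₁ c t₁ → Joins G e₂ c t₂ → Joins G e₃ c t₃ → ⊥
  path-no-three-edges-at (step _ _ u) p (there m₁) (there m₂) (there m₃) n₁₂ n₁₃ n₂₃ k₁ k₂ k₃ =
    path-no-three-edges-at u (AllPairs.tail p) m₁ m₂ m₃ n₁₂ n₁₃ n₂₃ k₁ k₂ k₃
  path-no-three-edges-at (step _ _ _) _ (here refl) (here refl) _ n₁₂ _ _ _ _ _ = n₁₂ refl
  path-no-three-edges-at (step _ _ _) _ (here refl) _ (here refl) _ n₁₃ _ _ _ _ = n₁₃ refl
  path-no-three-edges-at (step _ _ _) _ _ (here refl) (here refl) _ _ n₂₃ _ _ _ = n₂₃ refl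
  path-no-three-edges-at (step _ j u) p (here refl) (there m₂) (there m₃) _ _ n₂₃ k₁ k₂ k₃ =
    first-and-two-more {j = j} u p m₂ m₃ n₂₃ k₁ k₂ k₃
  path-no-three-edges-at (step _ j u) p (there m₁) (here refl) (there m₃) _ n₁₃ _ k₁ k₂ k₃ =
    first-and-two-more {j = j} u p m₁ m₃ n₁₃ k₂ k₁ k₃
  path-no-three-edges-at (step _ j u) p (there m₁) (there m₂) (here refl) n₁₂ _ _ k₁ k₂ k₃ =
    first-and-two-more {j = j} u p m₁ m₂ n₁₂ k₃ k₁ k₂

  IsCircle-++ʷ-step : ∀ {x a b e} (c : Walk G x a) (j : Joins G e a b) (d : Walk G b x) →
                      Unique (starts c ++ a ∷ starts d) → Unique (edges c ++ e ∷ edges d) →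
                      IsCircle (c ++ʷ step e j d)
  IsCircle-++ʷ-step c j d us ue =
    subst (0 <_) (cong length (sym (edges-++ʷ c (step _ j d)))) (∈-length (∈-++⁺ʳ (edges c) (here refl))) ,
    subst Unique (sym (starts-++ʷ c (step _ j d))) us ,
    subst Unique (sym (edges-++ʷ c (step _ j d))) ue

  IsCircle-closing⁻ : ∀ {x y e} (c : Walk G x y) (j : Joins G e y x) → IsCircle (c ++ʷ step e j []) →
                      Unique (starts c ++ [ y ]) × Unique (edges c ++ [ e ])
  IsCircle-closing⁻ c j (_ , us , ue) =
    subst Unique (starts-++ʷ c (step _ j [])) us , subst Unique (edges-++ʷ c (step _ j [])) ue

  IsCircle-rotate : ∀ {x y} (c : Walk G x y) (d : Walk G y x) → IsCircle (c ++ʷ d) → IsCircle (d ++ʷ c)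
  IsCircle-rotate c d (nonempty , us , ue) =
    subst (0 <_) (↭-length edges↭) nonempty ,
    Unique-resp-↭ (swapped starts starts-++ʷ) us ,
    Unique-resp-↭ edges↭ ue
    where
    swapped : ∀ {A : Set} (f : ∀ {x y} → Walk G x y → List A) →
              (∀ {x y z} (u : Walk G x y) (u' : Walk G y z) → f (u ++ʷ u') ≡ f u ++ f u') →
              f (c ++ʷ d) ↭ f (d ++ʷ c)
    swapped f f-++ = ↭-trans (↭-reflexive (f-++ c d)) (↭-trans (↭-++-comm (f c) (f d)) (↭-reflexive (sym (f-++ d c))))
    edges↭ = swapped edges edges-++ʷ

  circle-rest-path : ∀ {s t e} {j : Joins G e s t} (u : Walk G t s) → IsCircle (step e j u) → IsPath u
  circle-rest-path {s} u (_ , us , _) = Unique-resp-↭ (↭-++-comm [ s ] (starts u)) us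

module WalkImage {V : Set} {G H : Graph V} (f : Edge G → Edge H)
                 (f-joins : ∀ e x y → Joins G e x y → Joins H (f e) x y) where

  mapʷ : ∀ {x y} → Walk G x y → Walk H x y
  mapʷ []           = []
  mapʷ (step e j u) = step (f e) (f-joins e _ _ j) (mapʷ u)

  edges-mapʷ : ∀ {x y} (u : Walk G x y) → edges (mapʷ u) ≡ map f (edges u)
  edges-mapʷ []           = refl
  edges-mapʷ (step e j u) = cong (f e ∷_) (edges-mapʷ u)

  starts-mapʷ : ∀ {x y} (u : Walk G x y) → starts (mapʷ u) ≡ starts u
  starts-mapʷ []           = refl
  starts-mapʷ (step e j u) = cong (_ ∷_) (starts-mapʷ u)

  allNodes-mapʷ : ∀ {x y} (u : Walk G x y) → allNodes (mapʷ u) ≡ allNodes u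
  allNodes-mapʷ {y = y} u = cong (_++ [ y ]) (starts-mapʷ u)

  infix 4 _lifts_
  _lifts_ : ∀ {x y} → Walk G x y → Walk H x y → Set
  ũ lifts u = map f (edges ũ) ≡ edges u

  lifts-++ʷ : ∀ {x y z} {ũ : Walk G x y} {u : Walk H x y} {ũ' : Walk G y z} {u' : Walk H y z} →
              ũ lifts u → ũ' lifts u' → (ũ ++ʷ ũ') lifts (u ++ʷ u')
  lifts-++ʷ {ũ = ũ} {u} {ũ'} {u'} q q' = begin
    map f (edges (ũ ++ʷ ũ'))          ≡⟨ cong (map f) (edges-++ʷ ũ ũ') ⟩
    map f (edges ũ ++ edges ũ')       ≡⟨ map-++ f (edges ũ) (edges ũ') ⟩
    map f (edges ũ) ++ map f (edges ũ') ≡⟨ cong₂ _++_ q q' ⟩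
    edges u ++ edges u'               ≡⟨ edges-++ʷ u u' ⟨
    edges (u ++ʷ u')                  ∎
    where open ≡-Reasoning

  lifts-reverseʷ : ∀ {x y} {ũ : Walk G x y} {u : Walk H x y} → ũ lifts u → reverseʷ ũ lifts reverseʷ u
  lifts-reverseʷ {ũ = ũ} {u} q = begin
    map f (edges (reverseʷ ũ))   ≡⟨ cong (map f) (edges-reverseʷ ũ) ⟩
    map f (reverse (edges ũ))    ≡⟨ reverse-map f (edges ũ) ⟩
    reverse (map f (edges ũ))    ≡⟨ cong reverse q ⟩
    reverse (edges u)            ≡⟨ edges-reverseʷ u ⟨
    edges (reverseʷ u)           ∎
    where open ≡-Reasoning

  Joins-reflect : ∀ {e x y} → Joins H (f e) x y → Joins G e x y
  Joins-reflect {e} k with Joins-ends {G = H} (f-joins e _ _ (inj₁ refl)) k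
  ... | inj₁ (refl , refl) = inj₁ refl
  ... | inj₂ (refl , refl) = inj₂ refl

  starts-over : ∀ {x y} (ũ : Walk G x y) (u : Walk H x y) → ũ lifts u → starts ũ ≡ starts u
  starts-over []           []           _  = refl
  starts-over (step e j ũ) (step d k u) eq with ∷-injective eq
  ... | refl , eq' with Joins-other-end {G = H} (f-joins e _ _ j) k
  ...   | refl = cong (_ ∷_) (starts-over ũ u eq')

  allNodes-over : ∀ {x y} (ũ : Walk G x y) (u : Walk H x y) → ũ lifts u → allNodes ũ ≡ allNodes u
  allNodes-over {y = y} ũ u eq = cong (_++ [ y ]) (starts-over ũ u eq)

  lift-walk : (∀ d → ∃ λ e → f e ≡ d) → ∀ {x y} (u : Walk H x y) →
              Σ (Walk G x y) λ ũ → ũ lifts u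
  lift-walk onto []           = [] , refl
  lift-walk onto (step d k u) with onto d | lift-walk onto u
  ... | e , refl | ũ , eq = step e (Joins-reflect k) ũ , cong (f e ∷_) eq

module WalkPreimage {V : Set} {G H : Graph V} (ι : Edge G → Edge H)
                    (ι-ends : ∀ e → ends H (ι e) ≡ ends G e) where

  pull-walk : ∀ {x y} (u : Walk H x y) → All (λ d → Σ (Edge G) λ e → ι e ≡ d) (edges u) →
              Σ (Walk G x y) λ u' → map ι (edges u') ≡ edges u × starts u' ≡ starts u
  pull-walk []           _                 = [] , refl , refl
  pull-walk (step d k u) ((e , refl) ∷ es) =
    let (u' , eq₁ , eq₂) = pull-walk u es
    in  step e (Joins-pull k) u' , cong (ι e ∷_) eq₁ , cong (_ ∷_) eq₂
    where
    Joins-pull : ∀ {e x y} → Joins H (ι e) x y → Joins G e x y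
    Joins-pull {e} (inj₁ q) = inj₁ (trans (sym (ι-ends e)) q)
    Joins-pull {e} (inj₂ q) = inj₂ (trans (sym (ι-ends e)) q)

  IsCircle-preimage : ∀ {x} {u : Walk H x x} {u' : Walk G x x} → map ι (edges u') ≡ edges u → starts u' ≡ starts u →
                      IsCircle u → IsCircle u'
  IsCircle-preimage {u' = u'} edges≡ starts≡ (nonempty , us , ue) =
    subst (0 <_) (trans (cong length (sym edges≡)) (length-map ι (edges u'))) nonempty ,
    subst Unique (sym starts≡) us ,
    Unique-map⁻ (subst Unique (sym edges≡) ue)

module _ {V : Set} {Δ : Graph V} (X : Expansion Δ) where
  open WalkImage {G = graph (Ω X)} {H = Δ} (p X) (p-joins X)

  lifting-middle : ∀ {x a b} (c₁ : Walk Δ x a) (e : Edge Δ) (j : Joins Δ e a b) (c₂ : Walk Δ b x) →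
    IsCircle (c₁ ++ʷ step e j c₂) → (d₁ : Walk (graph (Ω X)) x a) (d₂ : Walk (graph (Ω X)) b x) →
    d₁ lifts c₁ → d₂ lifts c₂ → ∃! _≡_ (λ ẽ → p X ẽ ≡ e × Bal (Ω X) (edges d₁ ++ ẽ ∷ edges d₂))
  lifting-middle c₁ e j c₂ circle d₁ d₂ q₁ q₂ =
    ∃!-map (λ (pẽ , bal) → pẽ , Bal-↭ (Ω X) (rotated _) bal)
           (λ (pẽ , bal) → pẽ , Bal-↭ (Ω X) (↭-sym (rotated _)) bal)
      (lifting X (c₂ ++ʷ c₁) e j circle′ (d₂ ++ʷ d₁) (lifts-++ʷ q₂ q₁))
    where
    circle′ : IsCircle ((c₂ ++ʷ c₁) ++ʷ step e j [])
    circle′ = subst IsCircle (sym (++ʷ-assoc c₂ c₁ (step e j [])))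
                (IsCircle-rotate (c₁ ++ʷ step e j []) c₂ (subst IsCircle (sym (++ʷ-assoc c₁ (step e j []) c₂)) circle))
    rotated : ∀ ẽ → edges (d₂ ++ʷ d₁) ++ [ ẽ ] ↭ edges d₁ ++ ẽ ∷ edges d₂
    rotated ẽ = ↭-trans (↭-reflexive (cong (_++ [ ẽ ]) (edges-++ʷ d₂ d₁))) (++-snoc-rotate (edges d₁) (edges d₂) ẽ)

data Arm : Set where
  arm₁ arm₂ arm₃ : Arm

_≟ᵃ_ : (i j : Arm) → Dec (i ≡ j)
arm₁ ≟ᵃ arm₁ = yes refl
arm₂ ≟ᵃ arm₂ = yes refl
arm₃ ≟ᵃ arm₃ = yes refl
arm₁ ≟ᵃ arm₂ = no λ ()
arm₁ ≟ᵃ arm₃ = no λ ()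
arm₂ ≟ᵃ arm₁ = no λ ()
arm₂ ≟ᵃ arm₃ = no λ ()
arm₃ ≟ᵃ arm₁ = no λ ()
arm₃ ≟ᵃ arm₂ = no λ ()

third-arm : (s t : Arm) → s ≢ t → Σ Arm λ r → r ≢ s × r ≢ t
third-arm arm₁ arm₂ _ = arm₃ , (λ ()) , (λ ())
third-arm arm₂ arm₁ _ = arm₃ , (λ ()) , (λ ())
third-arm arm₁ arm₃ _ = arm₂ , (λ ()) , (λ ())
third-arm arm₃ arm₁ _ = arm₂ , (λ ()) , (λ ())
third-arm arm₂ arm₃ _ = arm₁ , (λ ()) , (λ ())
third-arm arm₃ arm₂ _ = arm₁ , (λ ()) , (λ ())
third-arm arm₁ arm₁ s≢t = ⊥-elim (s≢t refl)
third-arm arm₂ arm₂ s≢t = ⊥-elim (s≢t refl)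
third-arm arm₃ arm₃ s≢t = ⊥-elim (s≢t refl)

record FirstStep {V : Set} {G : Graph V} {a b : V} (u : Walk G a b) : Set where
  field
    next        : V
    first       : Edge G
    first-joins : Joins G first a next
    rest        : Walk G next b
    unfold      : u ≡ step first first-joins rest

firstStep : {V : Set} {G : Graph V} {a b : V} → a ≢ b → (u : Walk G a b) → FirstStep u
firstStep a≢b []           = ⊥-elim (a≢b refl)
firstStep a≢b (step e j u) = record { first = e ; first-joins = j ; rest = u ; unfold = refl }

module ThetaGraph {V : Set} (Δ : Graph V) (v w : V) (θ : IsThetaGraph Δ v w) where

  private
    module T = Theta (proj₁ θ)

    arm : Arm → Walk Δ v w
    arm arm₁ = T.P₁
    arm arm₂ = T.P₂
    arm arm₃ = T.P₃

    module S (i : Arm) = FirstStep (firstStep T.a≢b (arm i))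

  v≢w : v ≢ w
  v≢w = T.a≢b

  next : Arm → V
  next = S.next

  first : (i : Arm) → Edge Δ
  first = S.first

  first-joins : (i : Arm) → Joins Δ (first i) v (next i)
  first-joins = S.first-joins

  rest : (i : Arm) → Walk Δ (next i) w
  rest = S.rest

  -- Each arm is split into its first edge and the rest, so that its lifts are parametrised by
  -- the fibre over the first edge.
  P : Arm → Walk Δ v w
  P i = step (first i) (first-joins i) (rest i)

  inner : Arm → List V
  inner i = innerNodes (P i)

  private
    arm≡P : ∀ i {A : Set} (F : Walk Δ v w → A) → F (arm i) ≡ F (P i)
    arm≡P i F = cong F (S.unfold i)

  P-path : ∀ i → IsPath (P i)
  P-path i = subst Unique (arm≡P i allNodes) (path i)
    where
    path : ∀ i → IsPath (arm i)
    path arm₁ = T.path₁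
    path arm₂ = T.path₂
    path arm₃ = T.path₃

  private
    disjoint-arms : {A : Set} (f : Walk Δ v w → List A) →
      Disjoint (f T.P₁) (f T.P₂) → Disjoint (f T.P₁) (f T.P₃) → Disjoint (f T.P₂) (f T.P₃) →
      ∀ i j → i ≢ j → Disjoint (f (P i)) (f (P j))
    disjoint-arms f d₁₂ d₁₃ d₂₃ i j i≢j {z} p q =
      on-arms i j i≢j (subst (z ∈_) (sym (arm≡P i f)) p) (subst (z ∈_) (sym (arm≡P j f)) q)
      where
      on-arms : ∀ i j → i ≢ j → Disjoint (f (arm i)) (f (arm j))
      on-arms arm₁ arm₂ _ = d₁₂
      on-arms arm₁ arm₃ _ = d₁₃
      on-arms arm₂ arm₃ _ = d₂₃
      on-arms arm₂ arm₁ _ = λ p q → d₁₂ q p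
      on-arms arm₃ arm₁ _ = λ p q → d₁₃ q p
      on-arms arm₃ arm₂ _ = λ p q → d₂₃ q p
      on-arms arm₁ arm₁ i≢j = ⊥-elim (i≢j refl)
      on-arms arm₂ arm₂ i≢j = ⊥-elim (i≢j refl)
      on-arms arm₃ arm₃ i≢j = ⊥-elim (i≢j refl)

  P-edges-disjoint : ∀ i j → i ≢ j → Disjoint (edges (P i)) (edges (P j))
  P-edges-disjoint = disjoint-arms edges T.edges₁₂ T.edges₁₃ T.edges₂₃

  inner-disjoint : ∀ i j → i ≢ j → Disjoint (inner i) (inner j)
  inner-disjoint = disjoint-arms innerNodes T.inner₁₂ T.inner₁₃ T.inner₂₃

  arm-of-edge : ∀ e → Σ Arm λ i → e ∈ edges (P i)
  arm-of-edge e with proj₁ (proj₂ θ) e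
  ... | inj₁ p        = arm₁ , subst (e ∈_) (arm≡P arm₁ edges) p
  ... | inj₂ (inj₁ p) = arm₂ , subst (e ∈_) (arm≡P arm₂ edges) p
  ... | inj₂ (inj₂ p) = arm₃ , subst (e ∈_) (arm≡P arm₃ edges) p

  arm-of-node : ∀ x → Σ Arm λ i → x ∈ allNodes (P i)
  arm-of-node x with proj₂ (proj₂ θ) x
  ... | inj₁ p        = arm₁ , subst (x ∈_) (arm≡P arm₁ allNodes) p
  ... | inj₂ (inj₁ p) = arm₂ , subst (x ∈_) (arm≡P arm₂ allNodes) p
  ... | inj₂ (inj₂ p) = arm₃ , subst (x ∈_) (arm≡P arm₃ allNodes) p

  inner-unique : ∀ i → Unique (inner i)
  inner-unique i = Unique-++⁻ˡ (inner i) (AllPairs.tail (P-path i))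

  v∉inner : ∀ i → v ∉ inner i
  v∉inner i = source∉innerNodes (P i) (P-path i)

  w∉inner : ∀ i → w ∉ inner i
  w∉inner i = target∉innerNodes (P i) (P-path i)

  edge-at-inner : ∀ i {z e t} → z ∈ inner i → Joins Δ e z t → e ∈ edges (P i)
  edge-at-inner i {z} {e} z∈ k with arm-of-edge e
  ... | j , e∈ with i ≟ᵃ j
  ...   | yes refl = e∈
  ...   | no i≢j with allNodes-trichotomy (P j) (proj₁ (ends∈allNodes (P j) e∈ k))
  ...     | inj₁ refl        = ⊥-elim (v∉inner i z∈)
  ...     | inj₂ (inj₁ z∈′)  = ⊥-elim (inner-disjoint i j i≢j z∈ z∈′)
  ...     | inj₂ (inj₂ refl) = ⊥-elim (w∉inner i z∈)

  walk-stays-in-arm : ∀ k {y b} (Q : Walk Δ y b) → y ∈ allNodes (P k) → v ∉ starts Q → w ∉ starts Q →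
                      All (_∈ edges (P k)) (edges Q)
  walk-stays-in-arm k []           _  _   _   = []
  walk-stays-in-arm k (step e j Q) y∈ v∉ w∉ with allNodes-trichotomy (P k) y∈
  ... | inj₁ refl        = ⊥-elim (v∉ (here refl))
  ... | inj₂ (inj₂ refl) = ⊥-elim (w∉ (here refl))
  ... | inj₂ (inj₁ y∈′)  =
    e∈ ∷ walk-stays-in-arm k Q (proj₂ (ends∈allNodes (P k) e∈ j)) (λ p → v∉ (there p)) (λ p → w∉ (there p))
    where
    e∈ : e ∈ edges (P k)
    e∈ = edge-at-inner k y∈′ j

  VW : V → V → Set
  VW a b = (a ≡ v × b ≡ w) ⊎ (a ≡ w × b ≡ v)

  VW⇒≢ : ∀ {a b} → VW a b → a ≢ b
  VW⇒≢ (inj₁ (refl , refl)) = v≢w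
  VW⇒≢ (inj₂ (refl , refl)) = ≢-sym v≢w

  VW-rest-avoids : ∀ {a b t e} {j : Joins Δ e a t} (Q : Walk Δ t b) → VW a b → IsPath (step e j Q) →
                   v ∉ starts Q × w ∉ starts Q
  VW-rest-avoids {e = e} {j} Q (inj₁ (refl , refl)) p = source∉innerNodes (step e j Q) p , target∉innerNodes (step e j Q) p
  VW-rest-avoids {e = e} {j} Q (inj₂ (refl , refl)) p = target∉innerNodes (step e j Q) p , source∉innerNodes (step e j Q) p

  VW-path-within-arm : ∀ {a b} (Q : Walk Δ a b) → VW a b → IsPath Q → Σ Arm λ k → All (_∈ edges (P k)) (edges Q)
  VW-path-within-arm []           ab _ = ⊥-elim (VW⇒≢ ab refl)
  VW-path-within-arm (step e j Q) ab p with arm-of-edge e | VW-rest-avoids {j = j} Q ab p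
  ... | k , e∈ | v∉ , w∉ = k , e∈ ∷ walk-stays-in-arm k Q (proj₂ (ends∈allNodes (P k) e∈ j)) v∉ w∉

  nodes-within-arm : ∀ k {a b} (Q : Walk Δ a b) → a ∈ allNodes (P k) → All (_∈ edges (P k)) (edges Q) →
                     All (_∈ allNodes (P k)) (allNodes Q)
  nodes-within-arm k []           a∈ _          = a∈ ∷ []
  nodes-within-arm k (step e j Q) a∈ (e∈ ∷ es) = a∈ ∷ nodes-within-arm k Q (proj₂ (ends∈allNodes (P k) e∈ j)) es

module OverTheta {V : Set} (Δ : Graph V) (v w : V) (θ : IsThetaGraph Δ v w) (X : Expansion Δ) where
  open ThetaGraph Δ v w θ public

  G : Graph V
  G = graph (Ω X)

  open WalkImage {G = G} {H = Δ} (p X) (p-joins X) public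

  Balanced : List (Edge G) → Set
  Balanced = Bal (Ω X)

  BalancedUnion : ∀ {a b c d} → Walk G a b → Walk G c d → Set
  BalancedUnion A B = Balanced (edges A ++ edges B)

  BalancedUnion-sym : ∀ {a b c d} (A : Walk G a b) (B : Walk G c d) → BalancedUnion A B → BalancedUnion B A
  BalancedUnion-sym A B = Bal-↭ (Ω X) (↭-++-comm (edges A) (edges B))

  Bal-⇔ : ∀ {ls ls'} → ls ↭ ls' → Balanced ls ⇔ Balanced ls'
  Bal-⇔ ls↭ls' = mk⇔ (Bal-↭ (Ω X) ls↭ls') (Bal-↭ (Ω X) (↭-sym ls↭ls'))

  arms-circle-nodes : ∀ i j → i ≢ j → Unique (allNodes (P i) ++ inner j)
  arms-circle-nodes i j i≢j = Unique-++ (P-path i) (inner-unique j) disjoint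
    where
    disjoint : Disjoint (allNodes (P i)) (inner j)
    disjoint z∈ z∈′ with allNodes-trichotomy (P i) z∈
    ... | inj₁ refl        = v∉inner j z∈′
    ... | inj₂ (inj₁ z∈i)  = inner-disjoint i j i≢j z∈i z∈′
    ... | inj₂ (inj₂ refl) = w∉inner j z∈′

  arms-circle-edges : ∀ i j → i ≢ j → Unique (edges (P i) ++ edges (P j))
  arms-circle-edges i j i≢j =
    Unique-++ (IsPath⇒Unique-edges {u = P i} (P-path i)) (IsPath⇒Unique-edges {u = P j} (P-path j)) (P-edges-disjoint i j i≢j)

  lifted-rest : (i : Arm) → Walk G (next i) w
  lifted-rest i = proj₁ (lift-walk (p-surj X) (rest i))

  lifted-rest-lifts : ∀ i → lifted-rest i lifts rest i
  lifted-rest-lifts i = proj₂ (lift-walk (p-surj X) (rest i))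

  lift-closing-arm : ∀ k {x y} → VW x y → (c : Walk Δ x y) (c̃ : Walk G x y) → c̃ lifts c →
    Unique (allNodes c ++ inner k) → Unique (edges c ++ edges (P k)) →
    ∃! _≡_ (λ g → p X g ≡ first k × Balanced (edges c̃ ++ g ∷ edges (lifted-rest k)))
  lift-closing-arm k (inj₂ (refl , refl)) c c̃ c̃-lifts nodes-unique edges-unique =
    lifting-middle X c (first k) (first-joins k) (rest k) circle c̃ (lifted-rest k) c̃-lifts (lifted-rest-lifts k)
    where
    circle : IsCircle (c ++ʷ P k)
    circle = IsCircle-++ʷ-step c (first-joins k) (rest k) (subst Unique (++-assoc (starts c) [ v ] (inner k)) nodes-unique) edges-unique
  lift-closing-arm k (inj₁ (refl , refl)) c c̃ c̃-lifts nodes-unique edges-unique =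
    ∃!-map (λ (pg , bal) → pg , Bal-↭ (Ω X) (unreverse _) bal)
           (λ (pg , bal) → pg , Bal-↭ (Ω X) (↭-sym (unreverse _)) bal)
      (lift-closing-arm k (inj₂ (refl , refl)) (reverseʷ c) (reverseʷ c̃) (lifts-reverseʷ c̃-lifts)
        (Unique-resp-↭ (++⁺ʳ (inner k) (↭-sym (allNodes-reverseʷ-↭ c))) nodes-unique)
        (Unique-resp-↭ (++⁺ʳ (edges (P k)) (↭-sym (edges-reverseʷ-↭ c))) edges-unique))
    where
    unreverse : ∀ g → edges (reverseʷ c̃) ++ g ∷ edges (lifted-rest k) ↭ edges c̃ ++ g ∷ edges (lifted-rest k)
    unreverse g = ++⁺ʳ (g ∷ edges (lifted-rest k)) (edges-reverseʷ-↭ c̃)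

  liftArm : (i : Arm) (g : Edge G) → p X g ≡ first i → Walk G v w
  liftArm i g pg = step g (Joins-reflect (subst (λ d → Joins Δ d v (next i)) (sym pg) (first-joins i))) (lifted-rest i)

  liftArm-lifts : ∀ i g (pg : p X g ≡ first i) → liftArm i g pg lifts P i
  liftArm-lifts i g pg = cong₂ _∷_ pg (lifted-rest-lifts i)

  record ArmPath (s : Arm) : Set where
    field
      walk   : Walk G v w
      isPath : IsPath walk
      over   : All (λ e → p X e ∈ edges (P s)) (edges walk)

  open ArmPath public

  armPath : ∀ i g (pg : p X g ≡ first i) → ArmPath i
  armPath i g pg = record
    { walk   = liftArm i g pg
    ; isPath = subst Unique (sym (allNodes-over (liftArm i g pg) (P i) (liftArm-lifts i g pg))) (P-path i)
    ; over   = All.tabulate λ {e} e∈ → subst (p X e ∈_) (liftArm-lifts i g pg) (∈-map⁺ (p X) e∈) }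

  ArmPath-nodes : ∀ {s z} (A : ArmPath s) → z ∈ allNodes (walk A) → z ∈ allNodes (P s)
  ArmPath-nodes {s} A z∈ =
    All.lookup (nodes-within-arm s (mapʷ (walk A)) (here refl)
                 (subst (All (_∈ edges (P s))) (sym (edges-mapʷ (walk A))) (All.map⁺ (over A))))
               (subst (_ ∈_) (sym (allNodes-mapʷ (walk A))) z∈)

  ArmPath-inner : ∀ {s z} (A : ArmPath s) → z ∈ innerNodes (walk A) → z ∈ inner s
  ArmPath-inner {s} A z∈ with allNodes-trichotomy (P s) (ArmPath-nodes A (innerNodes⊆allNodes (walk A) z∈))
  ... | inj₁ refl         = ⊥-elim (source∉innerNodes (walk A) (isPath A) z∈)
  ... | inj₂ (inj₁ z∈s)   = z∈s
  ... | inj₂ (inj₂ refl)  = ⊥-elim (target∉innerNodes (walk A) (isPath A) z∈)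

  ArmPath-theta : ∀ {s₁ s₂ s₃} → ArmPath s₁ → ArmPath s₂ → ArmPath s₃ →
                  s₁ ≢ s₂ → s₁ ≢ s₃ → s₂ ≢ s₃ → Theta G v w
  ArmPath-theta {s₁} {s₂} {s₃} A B C s₁≢s₂ s₁≢s₃ s₂≢s₃ = record
    { a≢b = v≢w
    ; P₁ = walk A ; P₂ = walk B ; P₃ = walk C
    ; path₁ = isPath A ; path₂ = isPath B ; path₃ = isPath C
    ; inner₁₂ = λ p q → inner-disjoint s₁ s₂ s₁≢s₂ (ArmPath-inner A p) (ArmPath-inner B q)
    ; inner₁₃ = λ p q → inner-disjoint s₁ s₃ s₁≢s₃ (ArmPath-inner A p) (ArmPath-inner C q)
    ; inner₂₃ = λ p q → inner-disjoint s₂ s₃ s₂≢s₃ (ArmPath-inner B p) (ArmPath-inner C q)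
    ; edges₁₂ = λ p q → P-edges-disjoint s₁ s₂ s₁≢s₂ (All.lookup (over A) p) (All.lookup (over B) q)
    ; edges₁₃ = λ p q → P-edges-disjoint s₁ s₃ s₁≢s₃ (All.lookup (over A) p) (All.lookup (over C) q)
    ; edges₂₃ = λ p q → P-edges-disjoint s₂ s₃ s₂≢s₃ (All.lookup (over B) p) (All.lookup (over C) q) }

  balanced-transfer : ∀ {s₁ s₂ s₃} (A : ArmPath s₁) (B : ArmPath s₂) (C : ArmPath s₃) →
    s₁ ≢ s₂ → s₁ ≢ s₃ → s₂ ≢ s₃ →
    BalancedUnion (walk A) (walk B) → BalancedUnion (walk A) (walk C) → ¬ ¬ BalancedUnion (walk B) (walk C)
  balanced-transfer A B C s₁≢s₂ s₁≢s₃ s₂≢s₃ ab ac ¬bc =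
    theta (Ω X) (ArmPath-theta A B C s₁≢s₂ s₁≢s₃ s₂≢s₃) (ab , ac , ¬bc)

  path-within-arm : (A : Walk G v w) → IsPath A → Σ Arm λ k → All (λ e → p X e ∈ edges (P k)) (edges A)
  path-within-arm A A-path with VW-path-within-arm (mapʷ A) (inj₁ (refl , refl)) (subst Unique (sym (allNodes-mapʷ A)) A-path)
  ... | k , within = k , All.map⁻ (subst (All (_∈ edges (P k))) (edges-mapʷ A) within)

  orient : ∀ {a b} → VW a b → Walk G a b → Walk G v w
  orient (inj₁ (refl , refl)) W = W
  orient (inj₂ (refl , refl)) W = reverseʷ W

  orient-edges : ∀ {a b} (vw : VW a b) (W : Walk G a b) → edges (orient vw W) ↭ edges W
  orient-edges (inj₁ (refl , refl)) W = ↭-refl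
  orient-edges (inj₂ (refl , refl)) W = edges-reverseʷ-↭ W

  orient-path : ∀ {a b} (vw : VW a b) {W : Walk G a b} → IsPath W → IsPath (orient vw W)
  orient-path (inj₁ (refl , refl)) W-path = W-path
  orient-path (inj₂ (refl , refl)) W-path = IsPath-reverseʷ W-path

  ArmPaths-apart⇒≢ : ∀ {s t} (A : ArmPath s) (B : ArmPath t) →
                     (∀ {x y} → x ∈ edges (walk A) → y ∈ edges (walk B) → p X x ≢ p X y) → s ≢ t
  ArmPaths-apart⇒≢ {s} A B apart refl with first-edge (walk A) v≢w | first-edge (walk B) v≢w
  ... | x , _ , x∈ , jx | y , _ , y∈ , jy =
    apart x∈ y∈ (path-source-edge-unique (P s) (P-path s) (All.lookup (over A) x∈) (All.lookup (over B) y∈)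
                   (p-joins X x _ _ jx) (p-joins X y _ _ jy))

  -- A new edge over e_vw is named by an edge of Ω over the first edge of P arm₁, that is, by the
  -- lift lift₁ n of P arm₁.
  NewEdge : Set
  NewEdge = Σ (Edge G) λ f → p X f ≡ first arm₁

  NewEdge-≡ : {n n' : NewEdge} → proj₁ n ≡ proj₁ n' → n ≡ n'
  NewEdge-≡ {f , pf} {.f , pf'} refl = cong (f ,_) (uip pf pf')

  lift₁ : NewEdge → Walk G v w
  lift₁ n = liftArm arm₁ (proj₁ n) (proj₂ n)

  Closes : Arm → NewEdge → Edge G → Set
  Closes r n g = p X g ≡ first r × Balanced (edges (lift₁ n) ++ g ∷ edges (lifted-rest r))

  private
    closing : ∀ r → r ≢ arm₁ → ∀ n → ∃! _≡_ (Closes r n)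
    closing r r≢1 n = lift-closing-arm r (inj₁ (refl , refl)) (P arm₁) (lift₁ n) (liftArm-lifts arm₁ (proj₁ n) (proj₂ n))
                        (arms-circle-nodes arm₁ r (≢-sym r≢1)) (arms-circle-edges arm₁ r (≢-sym r≢1))

  companion-edge : Arm → NewEdge → Edge G
  companion-edge arm₁ n = proj₁ n
  companion-edge arm₂ n = proj₁ (closing arm₂ (λ ()) n)
  companion-edge arm₃ n = proj₁ (closing arm₃ (λ ()) n)

  companion-closes : ∀ r → r ≢ arm₁ → ∀ n →
                     Closes r n (companion-edge r n) × (∀ {g} → Closes r n g → companion-edge r n ≡ g)
  companion-closes arm₁ r≢1 n = ⊥-elim (r≢1 refl)
  companion-closes arm₂ _   n = proj₂ (closing arm₂ (λ ()) n)
  companion-closes arm₃ _   n = proj₂ (closing arm₃ (λ ()) n)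

  companion-edge-over : ∀ r n → p X (companion-edge r n) ≡ first r
  companion-edge-over arm₁ n = proj₂ n
  companion-edge-over arm₂ n = proj₁ (proj₁ (companion-closes arm₂ (λ ()) n))
  companion-edge-over arm₃ n = proj₁ (proj₁ (companion-closes arm₃ (λ ()) n))

  companion : (r : Arm) → NewEdge → ArmPath r
  companion r n = armPath r (companion-edge r n) (companion-edge-over r n)

  companionʷ : Arm → NewEdge → Walk G v w
  companionʷ r n = walk (companion r n)

  companion-balanced : ∀ r n → r ≢ arm₁ → BalancedUnion (companionʷ arm₁ n) (companionʷ r n)
  companion-balanced r n r≢1 = proj₂ (proj₁ (companion-closes r r≢1 n))

  companion-starts : ∀ σ n → starts (companionʷ σ n) ≡ v ∷ inner σ
  companion-starts σ n = cong (v ∷_) (starts-over (lifted-rest σ) (rest σ) (lifted-rest-lifts σ))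

  companion-reverse-starts : ∀ σ n → starts (reverseʷ (companionʷ σ n)) ↭ w ∷ inner σ
  companion-reverse-starts σ n =
    ↭-trans (drop-∷ (↭-trans (starts-reverseʷ-↭ Z) (↭-reflexive Z-nodes))) (↭-++-comm (inner σ) [ w ])
    where
    Z : Walk G v w
    Z = companionʷ σ n
    Z-nodes : allNodes Z ≡ allNodes (P σ)
    Z-nodes = allNodes-over Z (P σ) (liftArm-lifts σ (companion-edge σ n) (companion-edge-over σ n))

  private
    closing-to-arm₁ : ∀ r → r ≢ arm₁ → ∀ g (pg : p X g ≡ first r) →
      ∃! _≡_ (λ f → p X f ≡ first arm₁ × Balanced (edges (liftArm r g pg) ++ f ∷ edges (lifted-rest arm₁)))
    closing-to-arm₁ r r≢1 g pg = lift-closing-arm arm₁ (inj₁ (refl , refl)) (P r) (liftArm r g pg) (liftArm-lifts r g pg)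
                                   (arms-circle-nodes r arm₁ r≢1) (arms-circle-edges r arm₁ r≢1)

    companion-edge-injective′ : ∀ r → r ≢ arm₁ → ∀ {n n'} → companion-edge r n ≡ companion-edge r n' → n ≡ n'
    companion-edge-injective′ r r≢1 {n} {n'} eq with closing-to-arm₁ r r≢1 (companion-edge r n) (companion-edge-over r n)
    ... | _ , _ , unique = NewEdge-≡ (trans (sym (unique (proj₂ n , closes n refl))) (unique (proj₂ n' , closes n' eq)))
      where
      closes : ∀ m → companion-edge r n ≡ companion-edge r m →
               Balanced ((companion-edge r n ∷ edges (lifted-rest r)) ++ proj₁ m ∷ edges (lifted-rest arm₁))
      closes m eq = subst (λ g → Balanced ((g ∷ edges (lifted-rest r)) ++ proj₁ m ∷ edges (lifted-rest arm₁))) (sym eq)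
                      (Bal-↭ (Ω X) (↭-++-comm (edges (lift₁ m)) _) (companion-balanced r m r≢1))

    companion-edge-surjective′ : ∀ r → r ≢ arm₁ → ∀ g → p X g ≡ first r → Σ NewEdge λ n → companion-edge r n ≡ g
    companion-edge-surjective′ r r≢1 g pg with closing-to-arm₁ r r≢1 g pg
    ... | f , (pf , bal) , _ =
      (f , pf) , proj₂ (companion-closes r r≢1 (f , pf)) (pg , Bal-↭ (Ω X) (↭-++-comm (edges (liftArm r g pg)) _) bal)

  companion-edge-injective : ∀ r {n n'} → companion-edge r n ≡ companion-edge r n' → n ≡ n'
  companion-edge-injective arm₁ = NewEdge-≡
  companion-edge-injective arm₂ = companion-edge-injective′ arm₂ (λ ())
  companion-edge-injective arm₃ = companion-edge-injective′ arm₃ (λ ())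

  companion-edge-surjective : ∀ r g → p X g ≡ first r → Σ NewEdge λ n → companion-edge r n ≡ g
  companion-edge-surjective arm₁ g pg = (g , pg) , refl
  companion-edge-surjective arm₂      = companion-edge-surjective′ arm₂ (λ ())
  companion-edge-surjective arm₃      = companion-edge-surjective′ arm₃ (λ ())

  companions-balanced : ∀ r r' n → r ≢ r' → ¬ ¬ BalancedUnion (companionʷ r n) (companionʷ r' n)
  companions-balanced arm₁ arm₁ n r≢r' = ⊥-elim (r≢r' refl)
  companions-balanced arm₂ arm₂ n r≢r' = ⊥-elim (r≢r' refl)
  companions-balanced arm₃ arm₃ n r≢r' = ⊥-elim (r≢r' refl)
  companions-balanced arm₁ r'   n 1≢r' ¬bal = ¬bal (companion-balanced r' n (≢-sym 1≢r'))
  companions-balanced r   arm₁  n r≢1 ¬bal =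
    ¬bal (BalancedUnion-sym (companionʷ arm₁ n) (companionʷ r n) (companion-balanced r n r≢1))
  companions-balanced arm₂ arm₃ n _ =
    balanced-transfer (companion arm₁ n) (companion arm₂ n) (companion arm₃ n) (λ ()) (λ ()) (λ ())
      (companion-balanced arm₂ n (λ ())) (companion-balanced arm₃ n (λ ()))
  companions-balanced arm₃ arm₂ n _ =
    balanced-transfer (companion arm₁ n) (companion arm₃ n) (companion arm₂ n) (λ ()) (λ ()) (λ ())
      (companion-balanced arm₃ n (λ ())) (companion-balanced arm₂ n (λ ()))

  Avoids₁ : List (Edge G) → Set
  Avoids₁ = All (λ e → p X e ∉ edges (P arm₁))

  Meets₁ : List (Edge G) → Set
  Meets₁ = Any (λ e → p X e ∈ edges (P arm₁))

  BalancedWithNew : NewEdge → List (Edge G) → Set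
  BalancedWithNew n ls = (Avoids₁ ls × Balanced (edges (companionʷ arm₁ n) ++ ls))
                       ⊎ (Meets₁ ls × Balanced (edges (companionʷ arm₂ n) ++ ls))

  BalancedWithNew-↭ : ∀ {n ls ls'} → ls ↭ ls' → BalancedWithNew n ls → BalancedWithNew n ls'
  BalancedWithNew-↭ {n} ls↭ls' (inj₁ (avoids , bal)) =
    inj₁ (All-resp-↭ ls↭ls' avoids , Bal-↭ (Ω X) (++⁺ˡ (edges (companionʷ arm₁ n)) ls↭ls') bal)
  BalancedWithNew-↭ {n} ls↭ls' (inj₂ (meets , bal)) =
    inj₂ (Any-resp-↭ ls↭ls' meets , Bal-↭ (Ω X) (++⁺ˡ (edges (companionʷ arm₂ n)) ls↭ls') bal)

  other-side : Arm → Arm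
  other-side arm₁ = arm₂
  other-side arm₂ = arm₁
  other-side arm₃ = arm₁

  other-side-≢ : ∀ k → other-side k ≢ k
  other-side-≢ arm₁ ()
  other-side-≢ arm₂ ()
  other-side-≢ arm₃ ()

  BalancedWithNew-avoiding : ∀ n {ls} → Avoids₁ ls → BalancedWithNew n ls ⇔ Balanced (edges (companionʷ arm₁ n) ++ ls)
  BalancedWithNew-avoiding n avoids =
    mk⇔ (λ { (inj₁ (_ , bal)) → bal ; (inj₂ (meets , _)) → ⊥-elim (All¬⇒¬Any avoids meets) })
        (λ bal → inj₁ (avoids , bal))

  BalancedWithNew-meeting : ∀ n {ls} → Meets₁ ls → BalancedWithNew n ls ⇔ Balanced (edges (companionʷ arm₂ n) ++ ls)
  BalancedWithNew-meeting n meets =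
    mk⇔ (λ { (inj₁ (avoids , _)) → ⊥-elim (All¬⇒¬Any avoids meets) ; (inj₂ (_ , bal)) → bal })
        (λ bal → inj₂ (meets , bal))

  BalancedWithNew-within-arm : ∀ k n {ls e} → All (λ e → p X e ∈ edges (P k)) ls → e ∈ ls →
    BalancedWithNew n ls ⇔ Balanced (edges (walk (companion (other-side k) n)) ++ ls)
  BalancedWithNew-within-arm arm₁ n within e∈ = BalancedWithNew-meeting n (lose e∈ (All.lookup within e∈))
  BalancedWithNew-within-arm arm₂ n within _  = BalancedWithNew-avoiding n (All.map (P-edges-disjoint arm₂ arm₁ (λ ())) within)
  BalancedWithNew-within-arm arm₃ n within _  = BalancedWithNew-avoiding n (All.map (P-edges-disjoint arm₃ arm₁ (λ ())) within)

  private
    via-other-side : ∀ n {s} (A : ArmPath s) →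
                     BalancedWithNew n (edges (walk A)) ⇔ BalancedUnion (walk (companion (other-side s) n)) (walk A)
    via-other-side n {s} A with first-edge (walk A) v≢w
    ... | _ , _ , e∈ , _ = BalancedWithNew-within-arm s n (over A) e∈

  BalancedWithNew⇒companion : ∀ r n {s} (A : ArmPath s) → s ≢ r →
    BalancedWithNew n (edges (walk A)) → ¬ ¬ BalancedUnion (companionʷ r n) (walk A)
  BalancedWithNew⇒companion r n {s} A s≢r bwn with r ≟ᵃ other-side s
  ... | yes refl     = pure (Equivalence.to (via-other-side n A) bwn)
  ... | no  r≢side = do
    side-r ← companions-balanced (other-side s) r n (≢-sym r≢side)
    balanced-transfer (companion (other-side s) n) (companion r n) A (≢-sym r≢side) (other-side-≢ s) (≢-sym s≢r)
      side-r (Equivalence.to (via-other-side n A) bwn)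

  companion⇒BalancedWithNew : ∀ r n {s} (A : ArmPath s) → s ≢ r →
    BalancedUnion (companionʷ r n) (walk A) → ¬ ¬ BalancedWithNew n (edges (walk A))
  companion⇒BalancedWithNew r n {s} A s≢r bal with r ≟ᵃ other-side s
  ... | yes refl     = pure (Equivalence.from (via-other-side n A) bal)
  ... | no  r≢side = do
    r-side ← companions-balanced r (other-side s) n r≢side
    side-A ← balanced-transfer (companion r n) (companion (other-side s) n) A r≢side (≢-sym s≢r) (other-side-≢ s) r-side bal
    pure (Equivalence.from (via-other-side n A) side-A)

  -- With r the third arm, n behaves like its companion over r, so the theta property of Ω applies
  -- to the companion of n over r, A and B.
  theta-with-new : ∀ {sA sB} (A : ArmPath sA) (B : ArmPath sB) → sA ≢ sB → ∀ n →
    ¬ (BalancedWithNew n (edges (walk A)) × BalancedWithNew n (edges (walk B)) × ¬ BalancedUnion (walk A) (walk B)) ×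
    ¬ (BalancedWithNew n (edges (walk A)) × BalancedUnion (walk A) (walk B) × ¬ BalancedWithNew n (edges (walk B)))
  theta-with-new {sA} {sB} A B sA≢sB n with third-arm sA sB sA≢sB
  ... | r , r≢sA , r≢sB = new-first , new-second
    where
    Z : ArmPath r
    Z = companion r n
    new-first : ¬ (BalancedWithNew n (edges (walk A)) × BalancedWithNew n (edges (walk B)) × ¬ BalancedUnion (walk A) (walk B))
    new-first (nA , nB , ¬AB) = ¬¬⊥⇒⊥ do
      ZA ← BalancedWithNew⇒companion r n A (≢-sym r≢sA) nA
      ZB ← BalancedWithNew⇒companion r n B (≢-sym r≢sB) nB
      pure (theta (Ω X) (ArmPath-theta Z A B r≢sA r≢sB sA≢sB) (ZA , ZB , ¬AB))
    new-second : ¬ (BalancedWithNew n (edges (walk A)) × BalancedUnion (walk A) (walk B) × ¬ BalancedWithNew n (edges (walk B)))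
    new-second (nA , AB , ¬nB) = ¬¬⊥⇒⊥ do
      ZA ← BalancedWithNew⇒companion r n A (≢-sym r≢sA) nA
      pure (theta (Ω X) (ArmPath-theta A Z B (≢-sym r≢sA) sA≢sB r≢sB)
             (BalancedUnion-sym (walk Z) (walk A) ZA , AB , λ ZB → companion⇒BalancedWithNew r n B (≢-sym r≢sB) ZB ¬nB))

module Extension {V : Set} (Δ : Graph V) (v w : V) (θ : IsThetaGraph Δ v w) (X : Expansion Δ) where

  open OverTheta Δ v w θ X public

  Δ' : Graph V
  Δ' = addLink Δ v w

  G' : Graph V
  G' = record { Edge = Edge G ⊎ NewEdge ; ends = λ { (inj₁ e) → ends G e ; (inj₂ _) → v , w } }

  p' : Edge G' → Edge Δ'
  p' (inj₁ e) = just (p X e)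
  p' (inj₂ _) = nothing

  p'-joins : ∀ e x y → Joins G' e x y → Joins Δ' (p' e) x y
  p'-joins (inj₁ e) = p-joins X e
  p'-joins (inj₂ _) _ _ j = j

  open WalkImage {G = G'} {H = Δ'} p' p'-joins using ()
    renaming ( _lifts_ to _lifts′_; starts-over to starts-over′; Joins-reflect to Joins-reflect′
             ; mapʷ to mapʷ′; edges-mapʷ to edges-mapʷ′; allNodes-mapʷ to allNodes-mapʷ′; starts-mapʷ to starts-mapʷ′)

  private
    module PullΔ = WalkPreimage {G = Δ} {H = Δ'} just (λ _ → refl)
    module PullG = WalkPreimage {G = G} {H = G'} inj₁ (λ _ → refl)

  IsOld : Edge G' → Set
  IsOld ẽ = Σ (Edge G) λ e → inj₁ e ≡ ẽ

  all-old : (L̃ : List (Edge G')) → nothing ∉ map p' L̃ → All IsOld L̃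
  all-old []             _         = []
  all-old (inj₁ e ∷ L̃) nothing∉ = (e , refl) ∷ all-old L̃ (λ p → nothing∉ (there p))
  all-old (inj₂ _ ∷ L̃) nothing∉ = ⊥-elim (nothing∉ (here refl))

  -- Two new edges form an unbalanced digon, and no other circle can pass through two of them.
  BalancedSplit : List NewEdge → List (Edge G) → Set
  BalancedSplit []          ls = Balanced ls
  BalancedSplit (n ∷ [])    ls = BalancedWithNew n ls
  BalancedSplit (_ ∷ _ ∷ _) ls = ⊥

  Bal' : List (Edge G') → Set
  Bal' L = BalancedSplit (rights L) (lefts L)

  Bal'-↭ : ∀ {L L'} → L ↭ L' → Bal' L → Bal' L'
  Bal'-↭ L↭L' = split-↭ (rights-↭ L↭L') (lefts-↭ L↭L')
    where
    split-↭ : ∀ {ns ns' ls ls'} → ns ↭ ns' → ls ↭ ls' → BalancedSplit ns ls → BalancedSplit ns' ls'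
    split-↭ {[]}          ns↭ ls↭ rewrite ↭-empty-inv (↭-sym ns↭)     = Bal-↭ (Ω X) ls↭
    split-↭ {_ ∷ []}      ns↭ ls↭ rewrite ↭-singleton-inv (↭-sym ns↭) = BalancedWithNew-↭ ls↭
    split-↭ {_ ∷ _ ∷ _}   ns↭ ls↭ ()

  Bal'-⇔ : ∀ {L L'} → L ↭ L' → Bal' L ⇔ Bal' L'
  Bal'-⇔ L↭L' = mk⇔ (Bal'-↭ L↭L') (Bal'-↭ (↭-sym L↭L'))

  Bal'-split : ∀ L {ns ls} → rights L ≡ ns → lefts L ≡ ls → Bal' L ⇔ BalancedSplit ns ls
  Bal'-split L refl refl = mk⇔ id id

  Bal'-old : ∀ ls → Bal' (map inj₁ ls) ⇔ Balanced ls
  Bal'-old ls = Bal'-split (map inj₁ ls) (rights-map-inj₁ ls) (lefts-map-inj₁ ls)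

  Bal'-old-list : ∀ L̃ ls → map inj₁ ls ≡ L̃ → Bal' L̃ ⇔ Balanced ls
  Bal'-old-list _ ls refl = Bal'-old ls

  Bal'-new : ∀ n ls → Bal' (inj₂ n ∷ map inj₁ ls) ⇔ BalancedWithNew n ls
  Bal'-new n ls = Bal'-split (inj₂ n ∷ map inj₁ ls) (cong (n ∷_) (rights-map-inj₁ ls)) (lefts-map-inj₁ ls)

  -- Circle lifting in the extension

  record OldWalks {x y} (w₀ : Walk Δ' x y) (w̃₀ : Walk G' x y) : Set where
    field
      base        : Walk Δ x y
      top         : Walk G x y
      base-edges  : map just (edges base) ≡ edges w₀
      base-starts : starts base ≡ starts w₀
      top-edges   : map inj₁ (edges top) ≡ edges w̃₀
      top-lifts   : top lifts base

  old-walks : ∀ {x y} (w₀ : Walk Δ' x y) (w̃₀ : Walk G' x y) → w̃₀ lifts′ w₀ → nothing ∉ edges w₀ → OldWalks w₀ w̃₀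
  old-walks w₀ w̃₀ w̃₀-lifts nothing∉
    with PullΔ.pull-walk w₀ (all-just (edges w₀) nothing∉)
       | PullG.pull-walk w̃₀ (all-old (edges w̃₀) (subst (nothing ∉_) (sym w̃₀-lifts) nothing∉))
  ... | base , base-edges , base-starts | top , top-edges , _ = record
    { base = base ; top = top ; base-edges = base-edges ; base-starts = base-starts ; top-edges = top-edges
    ; top-lifts = map-injective just-injective (begin
        map just (map (p X) (edges top))   ≡⟨ map-p'-inj₁ (edges top) ⟨
        map p' (map inj₁ (edges top))      ≡⟨ cong (map p') top-edges ⟩
        map p' (edges w̃₀)                 ≡⟨ w̃₀-lifts ⟩
        edges w₀                           ≡⟨ base-edges ⟨
        map just (edges base)              ∎) }
    where
    open ≡-Reasoning
    map-p'-inj₁ : ∀ L → map p' (map inj₁ L) ≡ map just (map (p X) L)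
    map-p'-inj₁ []      = refl
    map-p'-inj₁ (e ∷ L) = cong (just (p X e) ∷_) (map-p'-inj₁ L)

  lifting-avoiding-new : ∀ {x y} (w₀ : Walk Δ' x y) (d : Edge Δ) (j : Joins Δ' (just d) y x) →
    IsCircle (w₀ ++ʷ step (just d) j []) → (w̃₀ : Walk G' x y) → w̃₀ lifts′ w₀ → nothing ∉ edges w₀ →
    ∃! _≡_ (λ ẽ → p' ẽ ≡ just d × Bal' (edges w̃₀ ++ [ ẽ ]))
  lifting-avoiding-new {y = y} w₀ d j circle w̃₀ w̃₀-lifts nothing∉ =
    ∃!-pushforward inj₁ only-old (∃!-map to from (lifting X base d j circle↓ top top-lifts))
    where
    open OldWalks (old-walks w₀ w̃₀ w̃₀-lifts nothing∉)
    circle↓ : IsCircle (base ++ʷ step d j [])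
    circle↓ with IsCircle-closing⁻ w₀ j circle
    ... | us , ue = IsCircle-++ʷ-step base j []
                      (subst (λ ss → Unique (ss ++ [ y ])) (sym base-starts) us)
                      (Unique-map⁻ (subst Unique (trans (cong (_++ [ just d ]) (sym base-edges))
                                                        (sym (map-++ just (edges base) [ d ]))) ue))
    only-old : ∀ {ẽ} → p' ẽ ≡ just d × Bal' (edges w̃₀ ++ [ ẽ ]) → Σ (Edge G) λ e → inj₁ e ≡ ẽ
    only-old {inj₁ e} _        = e , refl
    only-old {inj₂ _} (() , _)
    old-list : ∀ e → map inj₁ (edges top ++ [ e ]) ≡ edges w̃₀ ++ [ inj₁ e ]
    old-list e = trans (map-++ inj₁ (edges top) [ e ]) (cong (_++ [ inj₁ e ]) top-edges)
    to : ∀ {e} → p X e ≡ d × Balanced (edges top ++ [ e ]) → p' (inj₁ e) ≡ just d × Bal' (edges w̃₀ ++ [ inj₁ e ])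
    to {e} (pe , bal) = cong just pe , Equivalence.from (Bal'-old-list _ _ (old-list e)) bal
    from : ∀ {e} → p' (inj₁ e) ≡ just d × Bal' (edges w̃₀ ++ [ inj₁ e ]) → p X e ≡ d × Balanced (edges top ++ [ e ])
    from {e} (pe , bal) = just-injective pe , Equivalence.to (Bal'-old-list _ _ (old-list e)) bal

  VW-of-new : ∀ {s t} → Joins Δ' nothing s t → VW t s
  VW-of-new (inj₁ refl) = inj₂ (refl , refl)
  VW-of-new (inj₂ refl) = inj₁ (refl , refl)

  private
    rotated-circle-within-arm : ∀ {s t} (js : Joins Δ' nothing s t) (W : Walk Δ' t s) → IsCircle (step nothing js W) →
                                Σ Arm λ k → ∀ {d} → just d ∈ edges W → d ∈ edges (P k)
    rotated-circle-within-arm js W circle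
      with PullΔ.pull-walk W (all-just (edges W) (Unique[x∷xs]⇒x∉xs (proj₂ (proj₂ circle))))
    ... | W↓ , W↓-edges , W↓-starts
      with VW-path-within-arm W↓ (VW-of-new js)
             (subst Unique (cong (_++ [ _ ]) (sym W↓-starts)) (circle-rest-path {j = js} W circle))
    ...   | k , within = k , in-arm
      where
      in-arm : ∀ {d} → just d ∈ edges W → d ∈ edges (P k)
      in-arm just-d∈ with ∈-map⁻ just (subst (_ ∈_) (sym W↓-edges) just-d∈)
      ... | _ , d∈ , refl = All.lookup within d∈

  circle-old-edges-within-arm : ∀ {x} (C : Walk Δ' x x) → IsCircle C → nothing ∈ edges C →
    Σ Arm λ k → ∀ {d} → just d ∈ edges C → d ∈ edges (P k)
  circle-old-edges-within-arm C circle nothing∈ with split-at C nothing∈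
  ... | record { before = W₁ ; joins = js ; after = W₂ ; split = refl }
      with rotated-circle-within-arm js (W₂ ++ʷ W₁) (IsCircle-rotate W₁ (step nothing js W₂) circle)
  ...   | k , within = k , λ just-d∈ → in-rest (∈-resp-↭ (edges-++ʷ-comm W₁ (step nothing js W₂)) just-d∈)
    where
    in-rest : ∀ {d} → just d ∈ nothing ∷ edges (W₂ ++ʷ W₁) → d ∈ edges (P k)
    in-rest (there just-d∈) = within just-d∈

  circle-apart-from-arm : ∀ {x} (C : Walk Δ' x x) → IsCircle C → ∀ k → (∀ {d} → just d ∈ edges C → d ∈ edges (P k)) →
    ∀ σ → σ ≢ k → Unique (starts C ++ inner σ) × Unique (catMaybes (edges C) ++ edges (P σ))
  circle-apart-from-arm C (_ , starts-unique , edges-unique) k within σ σ≢k =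
    Unique-++ starts-unique (inner-unique σ) nodes-apart ,
    Unique-++ (Unique-catMaybes _ edges-unique) (IsPath⇒Unique-edges {u = P σ} (P-path σ)) edges-apart
    where
    edges-apart : Disjoint (catMaybes (edges C)) (edges (P σ))
    edges-apart d∈C d∈σ = P-edges-disjoint k σ (≢-sym σ≢k) (within (∈-catMaybes⁻ _ d∈C)) d∈σ
    leaving-inner : ∀ e {z t} → e ∈ edges C → Joins Δ' e z t → z ∉ inner σ
    leaving-inner nothing  _  (inj₁ refl) = v∉inner σ
    leaving-inner nothing  _  (inj₂ refl) = w∉inner σ
    leaving-inner (just d) d∈ j z∈ = P-edges-disjoint k σ (≢-sym σ≢k) (within d∈) (edge-at-inner σ z∈ j)
    nodes-apart : Disjoint (starts C) (inner σ)
    nodes-apart z∈C z∈σ with ∈starts⇒outgoing C z∈C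
    ... | e , _ , e∈ , j = leaving-inner e e∈ j z∈σ

  record ThroughNew {x} (C : Walk Δ' x x) : Set where
    field
      arm-of-old : Arm
      old-within : ∀ {d} → just d ∈ edges C → d ∈ edges (P arm-of-old)
      nodes-apart : Unique (starts C ++ inner (other-side arm-of-old))
      edges-apart : Unique (catMaybes (edges C) ++ edges (P (other-side arm-of-old)))

  through-new : ∀ {x} (C : Walk Δ' x x) → IsCircle C → nothing ∈ edges C → ThroughNew C
  through-new C circle nothing∈ with circle-old-edges-within-arm C circle nothing∈
  ... | k , within with circle-apart-from-arm C circle k within (other-side k) (other-side-≢ k)
  ...   | nodes-apart , edges-apart = record
    { arm-of-old = k ; old-within = within ; nodes-apart = nodes-apart ; edges-apart = edges-apart }

  -- The old edges of the circle lie in one arm; closing their lift in Ω through the other side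
  -- arm σ gives a unique edge over the first edge of P σ, which names a unique new edge.
  lifting-closing-new : ∀ {x y} (w₀ : Walk Δ' x y) (j : Joins Δ' nothing y x) → IsCircle (w₀ ++ʷ step nothing j []) →
    (w̃₀ : Walk G' x y) → w̃₀ lifts′ w₀ → ∃! _≡_ (λ ẽ → p' ẽ ≡ nothing × Bal' (edges w̃₀ ++ [ ẽ ]))
  lifting-closing-new {x} {y} w₀ j circle w̃₀ w̃₀-lifts =
    ∃!-pushforward inj₂ only-new
      (∃!-map to from
        (∃!-pullback (companion-edge σ) (companion-edge-injective σ) (λ (pg , _) → companion-edge-surjective σ _ pg)
          (lift-closing-arm σ (VW-of-new j) base top top-lifts nodes-unique edges-unique)))
    where
    edges-C : edges (w₀ ++ʷ step nothing j []) ≡ edges w₀ ++ [ nothing ]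
    edges-C = edges-++ʷ w₀ _
    open ThroughNew (through-new _ circle (subst (nothing ∈_) (sym edges-C) (∈-++⁺ʳ (edges w₀) (here refl))))
    σ : Arm
    σ = other-side arm-of-old
    nothing∉ : nothing ∉ edges w₀
    nothing∉ p = Unique-++⇒Disjoint (edges w₀) (subst Unique edges-C (proj₂ (proj₂ circle))) p (here refl)
    open OldWalks (old-walks w₀ w̃₀ w̃₀-lifts nothing∉)
    nodes-unique : Unique (allNodes base ++ inner σ)
    nodes-unique = subst (λ ns → Unique (ns ++ inner σ)) (trans (starts-++ʷ w₀ _) (cong (_++ [ y ]) (sym base-starts))) nodes-apart
    edges-unique : Unique (edges base ++ edges (P σ))
    edges-unique = subst (λ es → Unique (es ++ edges (P σ))) base-old-edges edges-apart
      where
      open ≡-Reasoning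
      base-old-edges : catMaybes (edges (w₀ ++ʷ step nothing j [])) ≡ edges base
      base-old-edges = begin
        catMaybes (edges (w₀ ++ʷ step nothing j []))   ≡⟨ cong catMaybes edges-C ⟩
        catMaybes (edges w₀ ++ [ nothing ])            ≡⟨ catMaybes-++ (edges w₀) [ nothing ] ⟩
        catMaybes (edges w₀) ++ []                     ≡⟨ ++-identityʳ _ ⟩
        catMaybes (edges w₀)                           ≡⟨ cong catMaybes base-edges ⟨
        catMaybes (map just (edges base))              ≡⟨ mapMaybe-just (edges base) ⟩
        edges base                                     ∎
    top-within : All (λ e → p X e ∈ edges (P arm-of-old)) (edges top)
    top-within = All.tabulate λ {e} e∈ →
      old-within (subst (_ ∈_) (sym edges-C) (∈-++⁺ˡ (subst (_ ∈_) base-edges (∈-map⁺ just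
        (subst (p X e ∈_) top-lifts (∈-map⁺ (p X) e∈))))))
    with-new : ∀ n → Bal' (edges w̃₀ ++ [ inj₂ n ]) ⇔ Balanced (edges top ++ companion-edge σ n ∷ edges (lifted-rest σ))
    with-new n = Equivalence-trans
      (Bal'-split (edges w̃₀ ++ [ inj₂ n ])
        (trans (rights-++ (edges w̃₀) _)
               (cong (_++ [ n ]) (trans (cong rights (sym top-edges)) (rights-map-inj₁ (edges top)))))
        (trans (lefts-++ (edges w̃₀) _)
               (trans (++-identityʳ _) (trans (cong lefts (sym top-edges)) (lefts-map-inj₁ (edges top))))))
      (Equivalence-trans
        (BalancedWithNew-within-arm arm-of-old n top-within (proj₁ (proj₂ (proj₂ (first-edge top (VW⇒≢ (VW-of-new j)))))))
        (Bal-⇔ (↭-++-comm (edges (companionʷ σ n)) (edges top))))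
    to : ∀ {n} → p X (companion-edge σ n) ≡ first σ × Balanced (edges top ++ companion-edge σ n ∷ edges (lifted-rest σ)) →
         p' (inj₂ n) ≡ nothing × Bal' (edges w̃₀ ++ [ inj₂ n ])
    to {n} (_ , bal) = refl , Equivalence.from (with-new n) bal
    from : ∀ {n} → p' (inj₂ n) ≡ nothing × Bal' (edges w̃₀ ++ [ inj₂ n ]) →
           p X (companion-edge σ n) ≡ first σ × Balanced (edges top ++ companion-edge σ n ∷ edges (lifted-rest σ))
    from {n} (_ , bal) = companion-edge-over σ n , Equivalence.to (with-new n) bal
    only-new : ∀ {ẽ} → p' ẽ ≡ nothing × Bal' (edges w̃₀ ++ [ ẽ ]) → Σ NewEdge λ n → inj₂ n ≡ ẽ
    only-new {inj₁ _} (() , _)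
    only-new {inj₂ n} _ = n , refl

  lefts-lifts : ∀ L̃ → map (p X) (lefts L̃) ≡ catMaybes (map p' L̃)
  lefts-lifts []             = refl
  lefts-lifts (inj₁ e ∷ L̃) = cong (p X e ∷_) (lefts-lifts L̃)
  lefts-lifts (inj₂ _ ∷ L̃) = lefts-lifts L̃

  lefts-lifts′ : ∀ {x y} (w̃₀ : Walk G' x y) (w₀ : Walk Δ' x y) → w̃₀ lifts′ w₀ →
                 map (p X) (lefts (edges w̃₀)) ≡ catMaybes (edges w₀)
  lefts-lifts′ w̃₀ w₀ w̃₀-lifts = trans (lefts-lifts (edges w̃₀)) (cong catMaybes w̃₀-lifts)

  rights-single : ∀ L̃ → Unique (map p' L̃) → nothing ∈ map p' L̃ → Σ NewEdge λ n → rights L̃ ≡ [ n ]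
  rights-single (inj₁ _ ∷ L̃) u (there nothing∈) = rights-single L̃ (AllPairs.tail u) nothing∈
  rights-single (inj₂ n ∷ L̃) u _                = n , cong (n ∷_) (no-rights L̃ (Unique[x∷xs]⇒x∉xs u))
    where
    no-rights : ∀ L̃ → nothing ∉ map p' L̃ → rights L̃ ≡ []
    no-rights []             _         = refl
    no-rights (inj₁ _ ∷ L̃) nothing∉ = no-rights L̃ (λ p → nothing∉ (there p))
    no-rights (inj₂ _ ∷ L̃) nothing∉ = ⊥-elim (nothing∉ (here refl))

  expand : Arm → ∀ {x y} → Walk G' x y → Walk G x y
  expand σ []                             = []
  expand σ (step (inj₁ e) j W)            = step e j (expand σ W)
  expand σ (step (inj₂ n) (inj₁ refl) W)  = companionʷ σ n ++ʷ expand σ W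
  expand σ (step (inj₂ n) (inj₂ refl) W)  = reverseʷ (companionʷ σ n) ++ʷ expand σ W

  expand-edges : ∀ σ {x y} (W : Walk G' x y) →
    edges (expand σ W) ↭ lefts (edges W) ++ concatMap (λ n → edges (companionʷ σ n)) (rights (edges W))
  expand-edges σ []                            = ↭-refl
  expand-edges σ (step (inj₁ e) j W)           = ↭-prep e (expand-edges σ W)
  expand-edges σ (step (inj₂ n) (inj₁ refl) W) =
    ↭-trans (↭-reflexive (edges-++ʷ Z (expand σ W)))
            (↭-trans (++⁺ˡ (edges Z) (expand-edges σ W)) (shifts (edges Z) (lefts (edges W))))
    where
    Z : Walk G v w
    Z = companionʷ σ n
  expand-edges σ (step (inj₂ n) (inj₂ refl) W) =
    ↭-trans (↭-reflexive (edges-++ʷ (reverseʷ Z) (expand σ W)))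
            (↭-trans (++⁺ (edges-reverseʷ-↭ Z) (expand-edges σ W)) (shifts (edges Z) (lefts (edges W))))
    where
    Z : Walk G v w
    Z = companionʷ σ n

  expand-starts : ∀ σ {x y} (W : Walk G' x y) →
    starts (expand σ W) ↭ starts W ++ concatMap (λ _ → inner σ) (rights (edges W))
  expand-starts σ []                            = ↭-refl
  expand-starts σ (step (inj₁ e) j W)           = ↭-prep _ (expand-starts σ W)
  expand-starts σ (step (inj₂ n) (inj₁ refl) W) =
    ↭-trans (↭-reflexive (trans (starts-++ʷ Z (expand σ W)) (cong (_++ starts (expand σ W)) (companion-starts σ n))))
            (↭-prep v (↭-trans (++⁺ˡ (inner σ) (expand-starts σ W)) (shifts (inner σ) (starts W))))
    where
    Z : Walk G v w
    Z = companionʷ σ n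
  expand-starts σ (step (inj₂ n) (inj₂ refl) W) =
    ↭-trans (↭-reflexive (starts-++ʷ (reverseʷ Z) (expand σ W)))
            (↭-trans (++⁺ʳ (starts (expand σ W)) (companion-reverse-starts σ n))
                     (↭-prep w (↭-trans (++⁺ˡ (inner σ) (expand-starts σ W)) (shifts (inner σ) (starts W)))))
    where
    Z : Walk G v w
    Z = companionʷ σ n

  expand-single-edges : ∀ σ {x y} (W : Walk G' x y) {n} → rights (edges W) ≡ [ n ] →
    edges (expand σ W) ↭ lefts (edges W) ++ edges (companionʷ σ n)
  expand-single-edges σ W {n} single =
    ↭-trans (expand-edges σ W)
      (↭-reflexive (trans (cong (λ ns → lefts (edges W) ++ concatMap (λ m → edges (companionʷ σ m)) ns) single)
                          (cong (lefts (edges W) ++_) (++-identityʳ (edges (companionʷ σ n))))))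

  expand-single-starts : ∀ σ {x y} (W : Walk G' x y) {n} → rights (edges W) ≡ [ n ] →
    starts (expand σ W) ↭ starts W ++ inner σ
  expand-single-starts σ W single =
    ↭-trans (expand-starts σ W)
      (↭-reflexive (trans (cong (λ ns → starts W ++ concatMap (λ _ → inner σ) ns) single)
                          (cong (starts W ++_) (++-identityʳ (inner σ)))))

  expanded-circle : ∀ {x y} (w₀ : Walk Δ' x y) (d : Edge Δ) (j : Joins Δ' (just d) y x) (w̃₀ : Walk G' x y) →
    w̃₀ lifts′ w₀ → (through : ThroughNew (w₀ ++ʷ step (just d) j [])) → ∀ {n} → rights (edges w̃₀) ≡ [ n ] →
    IsCircle (mapʷ (expand (other-side (ThroughNew.arm-of-old through)) w̃₀) ++ʷ step d j [])
  expanded-circle {y = y} w₀ d j w̃₀ w̃₀-lifts through {n} single =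
    IsCircle-++ʷ-step (mapʷ HW) j [] (Unique-resp-↭ nodes↭ nodes-apart) (Unique-resp-↭ edges↭ edges-apart)
    where
    open ThroughNew through
    open PermutationReasoning
    σ : Arm
    σ = other-side arm-of-old
    HW : Walk G _ y
    HW = expand σ w̃₀
    nodes↭ : starts (w₀ ++ʷ step (just d) j []) ++ inner σ ↭ starts (mapʷ HW) ++ [ y ]
    nodes↭ = begin
      starts (w₀ ++ʷ step (just d) j []) ++ inner σ  ≡⟨ cong (_++ inner σ) (starts-++ʷ w₀ _) ⟩
      (starts w₀ ++ [ y ]) ++ inner σ               ↭⟨ snoc-++-↭ (starts w₀) (inner σ) y ⟩
      (starts w₀ ++ inner σ) ++ [ y ]               ≡⟨ cong (λ ss → (ss ++ inner σ) ++ [ y ]) (starts-over′ w̃₀ w₀ w̃₀-lifts) ⟨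
      (starts w̃₀ ++ inner σ) ++ [ y ]              ↭⟨ ++⁺ʳ [ y ] (↭-sym (expand-single-starts σ w̃₀ single)) ⟩
      starts HW ++ [ y ]                            ≡⟨ cong (_++ [ y ]) (starts-mapʷ HW) ⟨
      starts (mapʷ HW) ++ [ y ]                     ∎
    edges↭ : catMaybes (edges (w₀ ++ʷ step (just d) j [])) ++ edges (P σ) ↭ edges (mapʷ HW) ++ [ d ]
    edges↭ = begin
      catMaybes (edges (w₀ ++ʷ step (just d) j [])) ++ edges (P σ)
        ≡⟨ cong (λ es → catMaybes es ++ edges (P σ)) (edges-++ʷ w₀ _) ⟩
      catMaybes (edges w₀ ++ [ just d ]) ++ edges (P σ)
        ≡⟨ cong (_++ edges (P σ)) (catMaybes-++ (edges w₀) [ just d ]) ⟩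
      (catMaybes (edges w₀) ++ [ d ]) ++ edges (P σ)
        ↭⟨ snoc-++-↭ (catMaybes (edges w₀)) (edges (P σ)) d ⟩
      (catMaybes (edges w₀) ++ edges (P σ)) ++ [ d ]
        ≡⟨ cong₂ (λ os zs → (os ++ zs) ++ [ d ]) (lefts-lifts′ w̃₀ w₀ w̃₀-lifts) (liftArm-lifts σ _ (companion-edge-over σ n)) ⟨
      (map (p X) (lefts (edges w̃₀)) ++ map (p X) (edges (companionʷ σ n))) ++ [ d ]
        ≡⟨ cong (_++ [ d ]) (map-++ (p X) (lefts (edges w̃₀)) _) ⟨
      map (p X) (lefts (edges w̃₀) ++ edges (companionʷ σ n)) ++ [ d ]
        ↭⟨ ++⁺ʳ [ d ] (↭-map⁺ (p X) (↭-sym (expand-single-edges σ w̃₀ single))) ⟩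
      map (p X) (edges HW) ++ [ d ]
        ≡⟨ cong (_++ [ d ]) (edges-mapʷ HW) ⟨
      edges (mapʷ HW) ++ [ d ]
        ∎

  -- Expanding the new edge into its companion over an arm disjoint from the circle turns the
  -- problem into circle lifting in Ω.
  lifting-through-new : ∀ {x y} (w₀ : Walk Δ' x y) (d : Edge Δ) (j : Joins Δ' (just d) y x) →
    IsCircle (w₀ ++ʷ step (just d) j []) → (w̃₀ : Walk G' x y) → w̃₀ lifts′ w₀ → nothing ∈ edges w₀ →
    ∃! _≡_ (λ ẽ → p' ẽ ≡ just d × Bal' (edges w̃₀ ++ [ ẽ ]))
  lifting-through-new w₀ d j circle w̃₀ w̃₀-lifts nothing∈
    with rights-single (edges w̃₀)
           (subst Unique (sym w̃₀-lifts) (Unique-++⁻ˡ (edges w₀) (proj₂ (IsCircle-closing⁻ w₀ j circle))))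
           (subst (nothing ∈_) (sym w̃₀-lifts) nothing∈)
  ... | n , single =
    ∃!-pushforward inj₁ only-old
      (∃!-map to from (lifting X (mapʷ HW) d j (expanded-circle w₀ d j w̃₀ w̃₀-lifts through single) HW (sym (edges-mapʷ HW))))
    where
    edges-C : edges (w₀ ++ʷ step (just d) j []) ≡ edges w₀ ++ [ just d ]
    edges-C = edges-++ʷ w₀ _
    through : ThroughNew (w₀ ++ʷ step (just d) j [])
    through = through-new _ circle (subst (nothing ∈_) (sym edges-C) (∈-++⁺ˡ nothing∈))
    open ThroughNew through
    σ : Arm
    σ = other-side arm-of-old
    HW : Walk G _ _
    HW = expand σ w̃₀
    Z : Walk G v w
    Z = companionʷ σ n
    old∈C : ∀ {e} → e ∈ lefts (edges w̃₀) → just (p X e) ∈ edges (w₀ ++ʷ step (just d) j [])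
    old∈C {e} e∈ = subst (_ ∈_) (sym edges-C) (∈-++⁺ˡ (∈-catMaybes⁻ (edges w₀)
                     (subst (p X e ∈_) (lefts-lifts′ w̃₀ w₀ w̃₀-lifts) (∈-map⁺ (p X) e∈))))
    within : ∀ {e} → p X e ≡ d → All (λ e′ → p X e′ ∈ edges (P arm-of-old)) (lefts (edges w̃₀) ++ [ e ])
    within refl = All.++⁺ (All.tabulate (λ e∈ → old-within (old∈C e∈)))
                          (old-within (subst (_ ∈_) (sym edges-C) (∈-++⁺ʳ (edges w₀) (here refl))) ∷ [])
    with-new : ∀ {e} → p X e ≡ d → Bal' (edges w̃₀ ++ [ inj₁ e ]) ⇔ Balanced (edges HW ++ [ e ])
    with-new {e} pe = Equivalence-trans
      (Bal'-split (edges w̃₀ ++ [ inj₁ e ]) (trans (rights-++ (edges w̃₀) _) (trans (++-identityʳ _) single))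
                  (lefts-++ (edges w̃₀) _))
      (Equivalence-trans (BalancedWithNew-within-arm arm-of-old n (within pe) (∈-++⁺ʳ (lefts (edges w̃₀)) (here refl)))
                         (Bal-⇔ (↭-sym rearranged)))
      where
      open PermutationReasoning
      rearranged : edges HW ++ [ e ] ↭ edges Z ++ lefts (edges w̃₀) ++ [ e ]
      rearranged = begin
        edges HW ++ [ e ]                          ↭⟨ ++⁺ʳ [ e ] (expand-single-edges σ w̃₀ single) ⟩
        (lefts (edges w̃₀) ++ edges Z) ++ [ e ]     ↭⟨ ++⁺ʳ [ e ] (↭-++-comm (lefts (edges w̃₀)) (edges Z)) ⟩
        (edges Z ++ lefts (edges w̃₀)) ++ [ e ]     ≡⟨ ++-assoc (edges Z) (lefts (edges w̃₀)) [ e ] ⟩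
        edges Z ++ lefts (edges w̃₀) ++ [ e ]       ∎
    to : ∀ {e} → p X e ≡ d × Balanced (edges HW ++ [ e ]) → p' (inj₁ e) ≡ just d × Bal' (edges w̃₀ ++ [ inj₁ e ])
    to (pe , bal) = cong just pe , Equivalence.from (with-new pe) bal
    from : ∀ {e} → p' (inj₁ e) ≡ just d × Bal' (edges w̃₀ ++ [ inj₁ e ]) → p X e ≡ d × Balanced (edges HW ++ [ e ])
    from (pe , bal) = just-injective pe , Equivalence.to (with-new (just-injective pe)) bal
    only-old : ∀ {ẽ} → p' ẽ ≡ just d × Bal' (edges w̃₀ ++ [ ẽ ]) → Σ (Edge G) λ e → inj₁ e ≡ ẽ
    only-old {inj₁ e} _        = e , refl
    only-old {inj₂ _} (() , _)

  lifting' : ∀ {x y} (w₀ : Walk Δ' x y) (eₗ : Edge Δ') (j : Joins Δ' eₗ y x) → IsCircle (w₀ ++ʷ step eₗ j []) →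
    (w̃₀ : Walk G' x y) → w̃₀ lifts′ w₀ → ∃! _≡_ (λ ẽ → p' ẽ ≡ eₗ × Bal' (edges w̃₀ ++ [ ẽ ]))
  lifting' w₀ nothing  j circle w̃₀ w̃₀-lifts = lifting-closing-new w₀ j circle w̃₀ w̃₀-lifts
  lifting' w₀ (just d) j circle w̃₀ w̃₀-lifts with any? is-nothing? (edges w₀)
    where
    is-nothing? : (m : Maybe (Edge Δ)) → Dec (nothing ≡ m)
    is-nothing? nothing  = yes refl
    is-nothing? (just _) = no λ ()
  ... | yes nothing∈ = lifting-through-new w₀ d j circle w̃₀ w̃₀-lifts nothing∈
  ... | no  nothing∉ = lifting-avoiding-new w₀ d j circle w̃₀ w̃₀-lifts nothing∉

  -- Theta subgraphs of the extension

  no-bal-digon' : ∀ (C : Circle G') e f → edges (Circle.walk C) ≡ e ∷ f ∷ [] → p' e ≡ p' f → ¬ Bal' (e ∷ f ∷ [])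
  no-bal-digon' C (inj₁ e) (inj₁ f) edges≡ pe≡pf bal
    with PullG.pull-walk (Circle.walk C) (subst (All IsOld) (sym edges≡) ((e , refl) ∷ (f , refl) ∷ []))
  ... | C↓ , C↓-edges , C↓-starts =
    no-bal-digon X record { walk = C↓ ; isCircle = PullG.IsCircle-preimage C↓-edges C↓-starts (Circle.isCircle C) }
      e f (map-injective inj₁-injective (trans C↓-edges edges≡)) (just-injective pe≡pf)
      (Equivalence.to (Bal'-old (e ∷ f ∷ [])) bal)
  no-bal-digon' C (inj₁ _) (inj₂ _) _ () _
  no-bal-digon' C (inj₂ _) (inj₁ _) _ () _
  no-bal-digon' C (inj₂ _) (inj₂ _) _ _  ()

  BalancedUnion' : ∀ {a b} → Walk G' a b → Walk G' a b → Set
  BalancedUnion' Q Q' = Bal' (edges Q ++ edges Q')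

  BalancedUnion'-sym : ∀ {a b} (Q Q' : Walk G' a b) → BalancedUnion' Q Q' → BalancedUnion' Q' Q
  BalancedUnion'-sym Q Q' = Bal'-↭ (↭-++-comm (edges Q) (edges Q'))

  Apart : ∀ {a b} → Walk G' a b → Walk G' a b → Set
  Apart Q Q' = ∀ {x y} → x ∈ edges Q → y ∈ edges Q' → p' x ≢ p' y

  Apart-sym : ∀ {a b} {Q Q' : Walk G' a b} → Apart Q Q' → Apart Q' Q
  Apart-sym apart x∈ y∈ eq = apart y∈ x∈ (sym eq)

  Apart-reverse : ∀ {a b} {Q Q' : Walk G' a b} → Apart Q Q' → Apart (reverseʷ Q) (reverseʷ Q')
  Apart-reverse {Q = Q} {Q'} apart x∈ y∈ =
    apart (∈-resp-↭ (edges-reverseʷ-↭ Q) x∈) (∈-resp-↭ (edges-reverseʷ-↭ Q') y∈)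

  parallel-edges-unbalanced : ∀ {a b x y} → a ≢ b → x ≢ y → Joins G' x a b → Joins G' y a b → p' x ≡ p' y →
                              ¬ Bal' (x ∷ y ∷ [])
  parallel-edges-unbalanced {x = x} {y} a≢b x≢y jx jy px≡py = no-bal-digon' digon x y refl px≡py
    where
    digon : Circle G'
    digon = record
      { walk     = step x jx (step y (Joins-sym {G = G'} {e = y} jy) [])
      ; isCircle = s≤s z≤n
                 , Unique-∷ (λ { (here a≡b) → a≢b a≡b }) (Unique-∷ (λ ()) [])
                 , Unique-∷ (λ { (here x≡y) → x≢y x≡y }) (Unique-∷ (λ ()) []) }

  parallel-paths : ∀ {a b} (Q Q' : Walk G' a b) → IsPath Q → IsPath Q' → Disjoint (innerNodes Q) (innerNodes Q') →
    ∀ {x y} → x ∈ edges Q → y ∈ edges Q' → p' x ≡ p' y →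
    (edges Q ≡ [ x ]) × (edges Q' ≡ [ y ]) × Joins G' x a b × Joins G' y a b
  parallel-paths {a} {b} Q Q' Q-path Q'-path inner-disjoint {x} {y} x∈ y∈ px≡py =
    path-single-edge Q Q-path x∈ (joins-ab {x} jx) , path-single-edge Q' Q'-path y∈ (joins-ab {y} jy) ,
    joins-ab {x} jx , joins-ab {y} jy
    where
    s t : V
    s = proj₁ (ends G' x)
    t = proj₂ (ends G' x)
    jx : Joins G' x s t
    jx = inj₁ refl
    jy : Joins G' y s t
    jy = Joins-reflect′ {e = y} (subst (λ d → Joins Δ' d s t) px≡py (p'-joins x s t jx))
    at-end : ∀ {z} → z ∈ allNodes Q → z ∈ allNodes Q' → z ≡ a ⊎ z ≡ b
    at-end = common-node-is-end Q Q' Q-path Q'-path inner-disjoint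
    not-loop : s ≢ t
    not-loop s≡t = path-edge-not-loop Q Q-path x∈ (subst (Joins G' x s) (sym s≡t) jx)
    joins-ab : ∀ {e} → Joins G' e s t → Joins G' e a b
    joins-ab {e} j = Joins-between-ends {G = G'} {e = e} j
      (at-end (proj₁ (ends∈allNodes Q x∈ jx)) (proj₁ (ends∈allNodes Q' y∈ jy)))
      (at-end (proj₂ (ends∈allNodes Q x∈ jx)) (proj₂ (ends∈allNodes Q' y∈ jy))) not-loop

  shared-fibre-unbalanced : ∀ {a b} (Q Q' : Walk G' a b) → IsPath Q → IsPath Q' → a ≢ b →
    Disjoint (innerNodes Q) (innerNodes Q') → Disjoint (edges Q) (edges Q') →
    ∀ {x y} → x ∈ edges Q → y ∈ edges Q' → p' x ≡ p' y → ¬ BalancedUnion' Q Q'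
  shared-fibre-unbalanced Q Q' Q-path Q'-path a≢b inner-disjoint edges-disjoint x∈ y∈ px≡py
    with parallel-paths Q Q' Q-path Q'-path inner-disjoint x∈ y∈ px≡py
  ... | Q≡x , Q'≡y , jx , jy =
    parallel-edges-unbalanced a≢b (λ { refl → edges-disjoint x∈ y∈ }) jx jy px≡py
      ∘ subst₂ (λ L L' → Bal' (L ++ L')) Q≡x Q'≡y

  balanced-closing-unique : ∀ {a b} (Q : Walk G' a b) → IsPath Q → ∀ {x y} → Joins G' x b a → p' x ≡ p' y →
    (∀ {z} → z ∈ edges Q → p' z ≢ p' x) → Bal' (edges Q ++ [ x ]) → Bal' (edges Q ++ [ y ]) → x ≡ y
  balanced-closing-unique {a} {b} Q Q-path {x} jx px≡py off-fibre bal-x bal-y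
    with lifting' (mapʷ′ Q) (p' x) (p'-joins x b a jx) circle Q (sym (edges-mapʷ′ Q))
    where
    Q↓-path : IsPath (mapʷ′ Q)
    Q↓-path = subst Unique (sym (allNodes-mapʷ′ Q)) Q-path
    fresh : p' x ∉ edges (mapʷ′ Q)
    fresh px∈ with ∈-map⁻ p' (subst (p' x ∈_) (edges-mapʷ′ Q) px∈)
    ... | z , z∈ , px≡pz = off-fibre z∈ (sym px≡pz)
    circle : IsCircle (mapʷ′ Q ++ʷ step (p' x) (p'-joins x b a jx) [])
    circle = IsCircle-++ʷ-step (mapʷ′ Q) (p'-joins x b a jx) []
               (subst (λ ss → Unique (ss ++ [ b ])) (sym (starts-mapʷ′ Q)) Q-path)
               (Unique-++ (IsPath⇒Unique-edges {u = mapʷ′ Q} Q↓-path) (Unique-∷ (λ ()) [])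
                          λ { p (here refl) → fresh p })
  ... | _ , _ , unique = trans (sym (unique (refl , bal-x))) (unique (sym px≡py , bal-y))

  projection-away-from-VW : ∀ {a t} f → Joins G' f a t → a ≢ v → a ≢ w → Σ (Edge Δ) λ d → p' f ≡ just d × Joins Δ d a t
  projection-away-from-VW (inj₁ e) j           _   _   = p X e , refl , p-joins X e _ _ j
  projection-away-from-VW (inj₂ _) (inj₁ refl) a≢v _   = ⊥-elim (a≢v refl)
  projection-away-from-VW (inj₂ _) (inj₂ refl) _   a≢w = ⊥-elim (a≢w refl)

  trivalent-end : ∀ {a b} (Q₁ Q₂ Q₃ : Walk G' a b) → a ≢ b → Apart Q₁ Q₂ → Apart Q₁ Q₃ → Apart Q₂ Q₃ →
                  ¬ (a ≢ v × a ≢ w)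
  trivalent-end {a} {b} Q₁ Q₂ Q₃ a≢b apart₁₂ apart₁₃ apart₂₃ (a≢v , a≢w) with arm-of-node a
  ... | r , a∈ with allNodes-trichotomy (P r) a∈
  ...   | inj₁ a≡v         = a≢v a≡v
  ...   | inj₂ (inj₂ a≡w)  = a≢w a≡w
  ...   | inj₂ (inj₁ a∈r)
        with first-edge Q₁ a≢b | first-edge Q₂ a≢b | first-edge Q₃ a≢b
  ...     | f₁ , _ , f₁∈ , j₁ | f₂ , _ , f₂∈ , j₂ | f₃ , _ , f₃∈ , j₃
          with projection-away-from-VW f₁ j₁ a≢v a≢w | projection-away-from-VW f₂ j₂ a≢v a≢w
             | projection-away-from-VW f₃ j₃ a≢v a≢w
  ...       | d₁ , pf₁ , k₁ | d₂ , pf₂ , k₂ | d₃ , pf₃ , k₃ =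
    path-no-three-edges-at (P r) (P-path r) (edge-at-inner r a∈r k₁) (edge-at-inner r a∈r k₂) (edge-at-inner r a∈r k₃)
      (distinct apart₁₂ f₁∈ f₂∈ pf₁ pf₂) (distinct apart₁₃ f₁∈ f₃∈ pf₁ pf₃) (distinct apart₂₃ f₂∈ f₃∈ pf₂ pf₃) k₁ k₂ k₃
    where
    distinct : ∀ {Q Q' : Walk G' a b} {f f' d d'} → Apart Q Q' → f ∈ edges Q → f' ∈ edges Q' →
               p' f ≡ just d → p' f' ≡ just d' → d ≢ d'
    distinct apart f∈ f'∈ pf pf' refl = apart f∈ f'∈ (trans pf (sym pf'))

  ends-trivalent : ∀ {a b} → ¬ (a ≢ v × a ≢ w) → ¬ (b ≢ v × b ≢ w) → a ≢ b → ¬ ¬ VW a b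
  ends-trivalent a-trivalent b-trivalent a≢b ¬vw = a-trivalent (a≢v , a≢w)
    where
    a≢v : _ ≢ v
    a≢v refl = b-trivalent ((λ { refl → a≢b refl }) , (λ { refl → ¬vw (inj₁ (refl , refl)) }))
    a≢w : _ ≢ w
    a≢w refl = b-trivalent ((λ { refl → ¬vw (inj₂ (refl , refl)) }) , (λ { refl → a≢b refl }))

  new-or-old : (L : List (Edge G')) → (Σ NewEdge λ n → inj₂ n ∈ L) ⊎ All IsOld L
  new-or-old []             = inj₂ []
  new-or-old (inj₂ n ∷ L) = inj₁ (n , here refl)
  new-or-old (inj₁ e ∷ L) with new-or-old L
  ... | inj₁ (n , n∈) = inj₁ (n , there n∈)
  ... | inj₂ old      = inj₂ ((e , refl) ∷ old)

  old-beside-new : ∀ {a b} {Q Q' : Walk G' a b} {n} → inj₂ n ∈ edges Q → Apart Q Q' → All IsOld (edges Q')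
  old-beside-new {Q' = Q'} n∈ apart with new-or-old (edges Q')
  ... | inj₁ (_ , m∈) = ⊥-elim (apart n∈ m∈ refl)
  ... | inj₂ old      = old

  record OldArmPath {a b} (Q : Walk G' a b) : Set where
    field
      arm-of      : Arm
      path↓       : ArmPath arm-of
      path↓-edges : map inj₁ (edges (walk path↓)) ↭ edges Q

  old-arm-path : ∀ {a b} → VW a b → (Q : Walk G' a b) → IsPath Q → All IsOld (edges Q) → OldArmPath Q
  old-arm-path {b = b} vw Q Q-path old with PullG.pull-walk Q old
  ... | Q↓ , Q↓-edges , Q↓-starts = oriented (orient-path vw (subst (λ ss → Unique (ss ++ [ b ])) (sym Q↓-starts) Q-path))
    where
    oriented : IsPath (orient vw Q↓) → OldArmPath Q
    oriented A-path with path-within-arm (orient vw Q↓) A-path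
    ... | k , within = record
      { arm-of      = k
      ; path↓       = record { walk = orient vw Q↓ ; isPath = A-path ; over = within }
      ; path↓-edges = ↭-trans (↭-map⁺ inj₁ (orient-edges vw Q↓)) (↭-reflexive Q↓-edges) }

  -- Equality of nodes is not decidable, so the ends of the theta are identified with v and w only
  -- up to double negation; this suffices since the goal is ⊥.
  theta-through-new : ∀ {a b} (N QA QB : Walk G' a b) → IsPath N → IsPath QA → IsPath QB → a ≢ b →
    Apart N QA → Apart N QB → Apart QA QB → ∀ {n} → inj₂ n ∈ edges N → All IsOld (edges QA) → All IsOld (edges QB) →
    ¬ (BalancedUnion' N QA × BalancedUnion' N QB × ¬ BalancedUnion' QA QB) ×
    ¬ (BalancedUnion' QA N × BalancedUnion' QA QB × ¬ BalancedUnion' N QB)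
  theta-through-new {a} {b} N QA QB N-path QA-path QB-path a≢b apart-NA apart-NB apart-AB {n} n∈ oldA oldB =
    (λ bals → ¬¬⊥⇒⊥ (vw >>= λ ab → pure (proj₁ (oriented ab) bals))) ,
    (λ bals → ¬¬⊥⇒⊥ (vw >>= λ ab → pure (proj₂ (oriented ab) bals)))
    where
    vw : ¬ ¬ VW a b
    vw = ends-trivalent (trivalent-end N QA QB a≢b apart-NA apart-NB apart-AB)
           (trivalent-end (reverseʷ N) (reverseʷ QA) (reverseʷ QB) (≢-sym a≢b)
              (Apart-reverse apart-NA) (Apart-reverse apart-NB) (Apart-reverse apart-AB))
           a≢b
    new-joins : VW a b → Joins G' (inj₂ n) a b
    new-joins (inj₁ (refl , refl)) = inj₁ refl
    new-joins (inj₂ (refl , refl)) = inj₂ refl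
    oriented : VW a b →
      ¬ (BalancedUnion' N QA × BalancedUnion' N QB × ¬ BalancedUnion' QA QB) ×
      ¬ (BalancedUnion' QA N × BalancedUnion' QA QB × ¬ BalancedUnion' N QB)
    oriented ab = (λ (NA , NB , ¬AB) → proj₁ core (toNew A NA , toNew B NB , ¬AB ∘ fromOld))
                , (λ (AN , AB , ¬NB) → proj₂ core (toNew A (BalancedUnion'-sym QA N AN) , toOld AB , ¬NB ∘ fromNew B))
      where
      open OldArmPath
      N-edges : edges N ≡ [ inj₂ n ]
      N-edges = path-single-edge N N-path n∈ (new-joins ab)
      A : OldArmPath QA
      A = old-arm-path ab QA QA-path oldA
      B : OldArmPath QB
      B = old-arm-path ab QB QB-path oldB
      LA LB : List (Edge G)
      LA = edges (walk (path↓ A))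
      LB = edges (walk (path↓ B))
      core : ¬ (BalancedWithNew n LA × BalancedWithNew n LB × ¬ Balanced (LA ++ LB)) ×
             ¬ (BalancedWithNew n LA × Balanced (LA ++ LB) × ¬ BalancedWithNew n LB)
      core = theta-with-new (path↓ A) (path↓ B)
               (ArmPaths-apart⇒≢ (path↓ A) (path↓ B) λ x∈ y∈ px≡py →
                  apart-AB (∈-resp-↭ (path↓-edges A) (∈-map⁺ inj₁ x∈)) (∈-resp-↭ (path↓-edges B) (∈-map⁺ inj₁ y∈))
                           (cong just px≡py))
               n
      with-new : ∀ {Q} (C : OldArmPath Q) → BalancedUnion' N Q ⇔ BalancedWithNew n (edges (walk (path↓ C)))
      with-new {Q} C = Equivalence-trans
        (Bal'-⇔ (↭-trans (↭-reflexive (cong (_++ edges Q) N-edges)) (↭-prep (inj₂ n) (↭-sym (path↓-edges C)))))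
        (Bal'-new n (edges (walk (path↓ C))))
      toNew : ∀ {Q} (C : OldArmPath Q) → BalancedUnion' N Q → BalancedWithNew n (edges (walk (path↓ C)))
      toNew C = Equivalence.to (with-new C)
      fromNew : ∀ {Q} (C : OldArmPath Q) → BalancedWithNew n (edges (walk (path↓ C))) → BalancedUnion' N Q
      fromNew C = Equivalence.from (with-new C)
      old-old : BalancedUnion' QA QB ⇔ Balanced (LA ++ LB)
      old-old = Equivalence-trans
        (Bal'-⇔ (↭-trans (++⁺ (↭-sym (path↓-edges A)) (↭-sym (path↓-edges B))) (↭-reflexive (sym (map-++ inj₁ LA LB)))))
        (Bal'-old (LA ++ LB))
      toOld : BalancedUnion' QA QB → Balanced (LA ++ LB)
      toOld = Equivalence.to old-old
      fromOld : Balanced (LA ++ LB) → BalancedUnion' QA QB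
      fromOld = Equivalence.from old-old

  theta-old : ∀ {a b} (T : Theta G' a b) → let open Theta T in
    All IsOld (edges P₁) → All IsOld (edges P₂) → All IsOld (edges P₃) →
    ¬ (BalancedUnion' P₁ P₂ × BalancedUnion' P₁ P₃ × ¬ BalancedUnion' P₂ P₃)
  theta-old {a} {b} T old₁ old₂ old₃ (b₁₂ , b₁₃ , ¬b₂₃) =
    theta (Ω X) T↓ (to-old Q₁ Q₂ b₁₂ , to-old Q₁ Q₃ b₁₃ , ¬b₂₃ ∘ from-old Q₂ Q₃)
    where
    open Theta T
    Pulled : Walk G' a b → Set
    Pulled Q = Σ (Walk G a b) λ Q↓ → map inj₁ (edges Q↓) ≡ edges Q × starts Q↓ ≡ starts Q
    Q₁ : Pulled P₁
    Q₁ = PullG.pull-walk P₁ old₁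
    Q₂ : Pulled P₂
    Q₂ = PullG.pull-walk P₂ old₂
    Q₃ : Pulled P₃
    Q₃ = PullG.pull-walk P₃ old₃
    path↓ : ∀ {Q} → IsPath Q → (Q↓ : Pulled Q) → IsPath (proj₁ Q↓)
    path↓ Q-path (_ , _ , starts≡) = subst (λ ss → Unique (ss ++ [ b ])) (sym starts≡) Q-path
    inner↓ : ∀ {Q Q'} → Disjoint (innerNodes Q) (innerNodes Q') → (Q↓ : Pulled Q) (Q'↓ : Pulled Q') →
             Disjoint (innerNodes (proj₁ Q↓)) (innerNodes (proj₁ Q'↓))
    inner↓ disjoint (_ , _ , s) (_ , _ , s') z∈ z∈′ =
      disjoint (subst (_ ∈_) (cong (drop 1) s) z∈) (subst (_ ∈_) (cong (drop 1) s') z∈′)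
    edges↓ : ∀ {Q Q'} → Disjoint (edges Q) (edges Q') → (Q↓ : Pulled Q) (Q'↓ : Pulled Q') →
             Disjoint (edges (proj₁ Q↓)) (edges (proj₁ Q'↓))
    edges↓ disjoint (_ , e , _) (_ , e' , _) x∈ x∈′ =
      disjoint (subst (_ ∈_) e (∈-map⁺ inj₁ x∈)) (subst (_ ∈_) e' (∈-map⁺ inj₁ x∈′))
    T↓ : Theta G a b
    T↓ = record
      { a≢b = a≢b ; P₁ = proj₁ Q₁ ; P₂ = proj₁ Q₂ ; P₃ = proj₁ Q₃
      ; path₁ = path↓ path₁ Q₁ ; path₂ = path↓ path₂ Q₂ ; path₃ = path↓ path₃ Q₃
      ; inner₁₂ = inner↓ inner₁₂ Q₁ Q₂ ; inner₁₃ = inner↓ inner₁₃ Q₁ Q₃ ; inner₂₃ = inner↓ inner₂₃ Q₂ Q₃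
      ; edges₁₂ = edges↓ edges₁₂ Q₁ Q₂ ; edges₁₃ = edges↓ edges₁₃ Q₁ Q₃ ; edges₂₃ = edges↓ edges₂₃ Q₂ Q₃ }
    old-old : ∀ {Q Q'} (Q↓ : Pulled Q) (Q'↓ : Pulled Q') →
              BalancedUnion' Q Q' ⇔ Balanced (edges (proj₁ Q↓) ++ edges (proj₁ Q'↓))
    old-old (Q↓ , e , _) (Q'↓ , e' , _) =
      Bal'-old-list _ _ (trans (map-++ inj₁ (edges Q↓) (edges Q'↓)) (cong₂ _++_ e e'))
    to-old : ∀ {Q Q'} (Q↓ : Pulled Q) (Q'↓ : Pulled Q') → BalancedUnion' Q Q' → Balanced (edges (proj₁ Q↓) ++ edges (proj₁ Q'↓))
    to-old Q↓ Q'↓ = Equivalence.to (old-old Q↓ Q'↓)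
    from-old : ∀ {Q Q'} (Q↓ : Pulled Q) (Q'↓ : Pulled Q') → Balanced (edges (proj₁ Q↓) ++ edges (proj₁ Q'↓)) → BalancedUnion' Q Q'
    from-old Q↓ Q'↓ = Equivalence.from (old-old Q↓ Q'↓)

  theta-apart : ∀ {a b} (T : Theta G' a b) → let open Theta T in
    Apart P₁ P₂ → Apart P₁ P₃ → Apart P₂ P₃ → ¬ (BalancedUnion' P₁ P₂ × BalancedUnion' P₁ P₃ × ¬ BalancedUnion' P₂ P₃)
  theta-apart T apart₁₂ apart₁₃ apart₂₃ (b₁₂ , b₁₃ , ¬b₂₃)
    with new-or-old (edges (Theta.P₁ T)) | new-or-old (edges (Theta.P₂ T)) | new-or-old (edges (Theta.P₃ T))
  ... | inj₁ (_ , n∈) | _ | _ =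
    proj₁ (theta-through-new P₁ P₂ P₃ path₁ path₂ path₃ a≢b apart₁₂ apart₁₃ apart₂₃ n∈
             (old-beside-new n∈ apart₁₂) (old-beside-new n∈ apart₁₃)) (b₁₂ , b₁₃ , ¬b₂₃)
    where open Theta T
  ... | inj₂ old₁ | inj₁ (_ , n∈) | _ =
    proj₂ (theta-through-new P₂ P₁ P₃ path₂ path₁ path₃ a≢b (Apart-sym apart₁₂) apart₂₃ apart₁₃ n∈
             old₁ (old-beside-new n∈ apart₂₃)) (b₁₂ , b₁₃ , ¬b₂₃)
    where open Theta T
  ... | inj₂ old₁ | inj₂ old₂ | inj₁ (_ , n∈) =
    proj₂ (theta-through-new P₃ P₁ P₂ path₃ path₁ path₂ a≢b (Apart-sym apart₁₃) (Apart-sym apart₂₃) apart₁₂ n∈ old₁ old₂)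
      (b₁₃ , b₁₂ , ¬b₂₃ ∘ BalancedUnion'-sym P₃ P₂)
    where open Theta T
  ... | inj₂ old₁ | inj₂ old₂ | inj₂ old₃ = theta-old T old₁ old₂ old₃ (b₁₂ , b₁₃ , ¬b₂₃)

  theta' : ∀ {a b} (T : Theta G' a b) → let open Theta T in
    ¬ (Bal' (edges P₁ ++ edges P₂) × Bal' (edges P₁ ++ edges P₃) × ¬ Bal' (edges P₂ ++ edges P₃))
  theta' T (b₁₂ , b₁₃ , ¬b₂₃) = theta-apart T apart₁₂ apart₁₃ apart₂₃ (b₁₂ , b₁₃ , ¬b₂₃)
    where
    open Theta T
    apart₁₂ : Apart P₁ P₂
    apart₁₂ x∈ y∈ px≡py = shared-fibre-unbalanced P₁ P₂ path₁ path₂ a≢b inner₁₂ edges₁₂ x∈ y∈ px≡py b₁₂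
    apart₁₃ : Apart P₁ P₃
    apart₁₃ x∈ y∈ px≡py = shared-fibre-unbalanced P₁ P₃ path₁ path₃ a≢b inner₁₃ edges₁₃ x∈ y∈ px≡py b₁₃
    -- P₂ and P₃ are parallel edges in one fibre; P₁ misses that fibre (by apart₁₂), so both close
    -- P₁ to a balanced circle and coincide by uniqueness of lifts.
    apart₂₃ : Apart P₂ P₃
    apart₂₃ {x} {y} x∈ y∈ px≡py with parallel-paths P₂ P₃ path₂ path₃ inner₂₃ x∈ y∈ px≡py
    ... | P₂≡x , P₃≡y , jx , _ =
      edges₂₃ x∈ (subst (_∈ edges P₃) (sym x≡y) y∈)
      where
      x≡y : x ≡ y
      x≡y = balanced-closing-unique P₁ path₁ (Joins-sym {G = G'} {e = x} jx) px≡py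
              (λ z∈ pz≡px → apart₁₂ z∈ x∈ pz≡px)
              (subst (λ L → Bal' (edges P₁ ++ L)) P₂≡x b₁₂) (subst (λ L → Bal' (edges P₁ ++ L)) P₃≡y b₁₃)

  X' : Expansion (addLink Δ v w)
  X' = record
    { Ω            = record { graph = G' ; Bal = Bal' ; Bal-↭ = Bal'-↭ ; theta = theta' }
    ; p            = p'
    ; p-joins      = p'-joins
    ; p-surj       = onto
    ; no-bal-digon = no-bal-digon'
    ; lifting      = lifting' }
    where
    onto : ∀ d → ∃ λ ẽ → p' ẽ ≡ d
    onto nothing  = inj₂ (p-surj X (first arm₁)) , refl
    onto (just d) = let (e , pe) = p-surj X d in inj₁ e , cong just pe

  restricts : RestrictsTo X' X
  restricts = record
    { ι      = inj₁
    ; ι-inj  = λ _ _ → inj₁-injective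
    ; ι-ends = λ _ → refl
    ; ι-p    = λ _ → refl
    ; ι-onto = λ { (inj₁ e) _ _ → e , refl ; (inj₂ _) _ () }
    ; ι-bal  = λ C → Equivalence-sym (Bal'-old (edges (Circle.walk C))) }

lemma3p9 : {V : Set} (Δ : Graph V) (v w : V) → IsThetaGraph Δ v w →
    (X : Expansion Δ) →
    Σ (Expansion (addLink Δ v w)) (λ X' → RestrictsTo X' X)
lemma3p9 Δ v w θ X = X' , restricts
  where open Extension Δ v w θ X
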